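{- Let $n>m\geq 2$ and let $A\subseteq\mathbb{Z}_{p^s}^n$. Then $A$ is a vertex of $G_{p^s}(n,m)$ (i.e. an $m$-subspace) if and only if there are two vertices $P_1,P_2$ of $G_{p^s}(n,m-1)$ such that $P_1\stackrel{mc}{\sim}P_2$ and $P_1\vee P_2=\{A\}$.
   Context: $p$ is a prime, $s\ge1$, $R=\mathbb{Z}_{p^s}$; vectors are row vectors. A set of $k$ vectors is unimodular if the matrix with those rows has a right inverse. For a submodule $V$, $\dim(V)$ is the largest size of a unimodular subset. A $k$-subspace is a submodule with a unimodular basis of $k$ vectors, identified with a matrix whose rows form such a basis; $\begin{pmatrix}X\\ Y\end{pmatrix}$ stacks representations. $G_{p^s}(n,k)$ has vertex set the $k$-subspaces of $R^n$, with $X\sim Y$ iff $X\cap Y$ is a linear subset of dimension $k-1$. Inner rank $\rho(M)$: least $r$ with $M=CD$, $C$ having $r$ columns. McCoy rank: with $I_j(M)$ the ideal generated by $j\times j$ minors ($I_0=R$), $\mathrm{rk}(M)=\max\{j:\mathrm{Ann}_R(I_j(M))=(0)\}$. Vertices $X,Y$ of $G_{p^s}(n,k)$ are Mc-adjacent, $X\stackrel{mc}{\sim}Y$, if $\rho\begin{pmatrix}X\\ Y\end{pmatrix}=\mathrm{rk}\begin{pmatrix}X\\ Y\end{pmatrix}=k+1$. $X\vee Y$ is the set of all subspaces of minimal dimension containing both $X$ and $Y$. -}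

module Defs where

open import Data.Nat using (ℕ; zero; suc; _+_; _*_; _∸_; _≤_)
open import Data.Nat.DivMod using (_mod_)
open import Data.Fin using (Fin; toℕ; punchIn; _≟_) renaming (zero to fzero; suc to fsuc)
open import Data.Bool using (if_then_else_)
open import Data.Product using (Σ; ∃; ∃-syntax; _×_; _,_)
open import Data.Unit using (⊤)
open import Data.Vec.Functional using (_++_)
open import Relation.Binary.PropositionalEquality using (_≡_)
open import Relation.Nullary.Decidable using (⌊_⌋)
open import Function.Definitions using (Injective)
open import Function.Bundles using (_⇔_)

-- The ring R = ℤ_q with q = suc k (the statement takes suc k ≡ p ^ s).
-- Elements are canonical residues Fin (suc k).

ℤq : ℕ → Set
ℤq k = Fin (suc k)

module _ {k : ℕ} where

  infixl 6 _+ᵣ_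
  infixl 7 _*ᵣ_

  _+ᵣ_ : ℤq k → ℤq k → ℤq k
  a +ᵣ b = (toℕ a + toℕ b) mod suc k

  _*ᵣ_ : ℤq k → ℤq k → ℤq k
  a *ᵣ b = (toℕ a * toℕ b) mod suc k

  -ᵣ_ : ℤq k → ℤq k
  -ᵣ a = (suc k ∸ toℕ a) mod suc k

  0ᵣ : ℤq k
  0ᵣ = fzero

  1ᵣ : ℤq k
  1ᵣ = 1 mod suc k

  Σᵣ : ∀ {j} → (Fin j → ℤq k) → ℤq k
  Σᵣ {zero}  f = 0ᵣ
  Σᵣ {suc j} f = f fzero +ᵣ Σᵣ (λ i → f (fsuc i))

Vect : ℕ → ℕ → Set
Vect k n = Fin n → ℤq k

Mat : ℕ → ℕ → ℕ → Set
Mat k a b = Fin a → Fin b → ℤq k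

Subset : ℕ → ℕ → Set₁
Subset k n = Vect k n → Set

module _ {k : ℕ} where

  _·_ : ∀ {a b c} → Mat k a b → Mat k b c → Mat k a c
  (M · N) i j = Σᵣ (λ l → M i l *ᵣ N l j)

  idMat : ∀ {a} → Mat k a a
  idMat i j = if ⌊ i ≟ j ⌋ then 1ᵣ else 0ᵣ

  _≈ₘ_ : ∀ {a b} → Mat k a b → Mat k a b → Set
  M ≈ₘ N = ∀ i j → M i j ≡ N i j

  -- a family of a vectors (rows of M) is unimodular: M has a right inverse
  Unimodular : ∀ {a n} → Mat k a n → Set
  Unimodular {a} {n} M = ∃[ N ] ((_·_ {c = a} M N) ≈ₘ idMat)

  comb : ∀ {a n} → (Fin a → ℤq k) → Mat k a n → Vect k n
  comb c M j = Σᵣ (λ i → c i *ᵣ M i j)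

  RowSpan : ∀ {a n} → Mat k a n → Subset k n
  RowSpan M v = ∃[ c ] (∀ j → v j ≡ comb c M j)

  _⊆_ : ∀ {n} → Subset k n → Subset k n → Set
  X ⊆ Y = ∀ v → X v → Y v

  _≐_ : ∀ {n} → Subset k n → Subset k n → Set
  X ≐ Y = ∀ v → X v ⇔ Y v

  IsSubmodule : ∀ {n} → Subset k n → Set
  IsSubmodule V = V (λ _ → 0ᵣ)
                × (∀ u v → V u → V v → V (λ j → u j +ᵣ v j))
                × (∀ r v → V v → V (λ j → r *ᵣ v j))

  LinIndep : ∀ {a n} → Mat k a n → Set
  LinIndep M = ∀ c → (∀ j → comb c M j ≡ 0ᵣ) → ∀ i → c i ≡ 0ᵣ

  IsBasis : ∀ {a n} → Mat k a n → Subset k n → Set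
  IsBasis M V = (∀ v → V v ⇔ RowSpan M v) × LinIndep M

  IsSubspace : ∀ {n} → ℕ → Subset k n → Set
  IsSubspace {n} d V = IsSubmodule V × ∃[ M ] (Unimodular {d} {n} M × IsBasis M V)

  HasUnimodSubset : ∀ {n} → Subset k n → ℕ → Set
  HasUnimodSubset {n} V d =
    ∃[ M ] (Unimodular {d} {n} M × Injective _≡_ _≡_ M × (∀ i → V (M i)))

  HasDim : ∀ {n} → Subset k n → ℕ → Set
  HasDim V d = HasUnimodSubset V d × (∀ d' → HasUnimodSubset V d' → d' ≤ d)

  -- Z ∈ X ∨ Y : Z is a subspace of minimal dimension containing X and Y
  InJoin : ∀ {n} → Subset k n → Subset k n → Subset k n → Set₁
  InJoin X Y Z =
    (∃[ d ] IsSubspace d Z) × X ⊆ Z × Y ⊆ Z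
    × (∀ Z' → (∃[ d' ] IsSubspace d' Z') → X ⊆ Z' → Y ⊆ Z' →
       ∀ d d' → HasDim Z d → HasDim Z' d' → d ≤ d')

  JoinIs : ∀ {n} → Subset k n → Subset k n → Subset k n → Set₁
  JoinIs X Y A = ∀ Z → InJoin X Y Z ⇔ (Z ≐ A)

  sgn : ∀ {j} → Fin j → ℤq k
  sgn fzero    = 1ᵣ
  sgn (fsuc i) = -ᵣ sgn i

  det : ∀ {j} → Mat k j j → ℤq k
  det {zero}  M = 1ᵣ
  det {suc j} M =
    Σᵣ (λ i → sgn i *ᵣ (M fzero i *ᵣ det (λ r c → M (fsuc r) (punchIn i c))))

  IsMinor : ∀ {a b} → ℕ → Mat k a b → ℤq k → Set
  IsMinor {a} {b} j M x =
    ∃[ f ] ∃[ g ] (Injective _≡_ _≡_ f × Injective _≡_ _≡_ g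
      × x ≡ det {j = j} (λ r c → M (f r) (g c)))

  InIdeal : (ℤq k → Set) → ℤq k → Set
  InIdeal G y = Σ ℕ λ t → Σ (Fin t → ℤq k) λ c → Σ (Fin t → ℤq k) λ g →
    ((∀ i → G (g i)) × y ≡ Σᵣ {j = t} (λ i → c i *ᵣ g i))

  MinorIdeal : ∀ {a b} → ℕ → Mat k a b → ℤq k → Set
  MinorIdeal zero    M y = ⊤
  MinorIdeal (suc j) M y = InIdeal (IsMinor (suc j) M) y

  AnnZero : (ℤq k → Set) → Set
  AnnZero I = ∀ x → (∀ y → I y → x *ᵣ y ≡ 0ᵣ) → x ≡ 0ᵣ

  McCoyRank : ∀ {a b} → Mat k a b → ℕ → Set
  McCoyRank M r = AnnZero (MinorIdeal r M)
                × (∀ j → AnnZero (MinorIdeal j M) → j ≤ r)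

  FactorsThrough : ∀ {a b} → Mat k a b → ℕ → Set
  FactorsThrough {a} {b} M r = ∃[ C ] ∃[ D ] (M ≈ₘ (_·_ {a} {r} {b} C D))

  InnerRank : ∀ {a b} → Mat k a b → ℕ → Set
  InnerRank M r = FactorsThrough M r × (∀ r' → FactorsThrough M r' → r ≤ r')

  McAdjMat : ∀ {d n} → Mat k d n → Mat k d n → Set
  McAdjMat {d} X Y = InnerRank (X ++ Y) (suc d) × McCoyRank (X ++ Y) (suc d)

  McAdj : ∀ {n} → ℕ → Subset k n → Subset k n → Set
  McAdj {n} d P₁ P₂ = ∃[ X ] ∃[ Y ]
    (Unimodular {d} {n} X × IsBasis X P₁ × Unimodular Y × IsBasis Y P₂ × McAdjMat X Y)

module Submission where

-- If the rows of B form a basis of the m-subspace A, take for P₁ and P₂ the spans of the first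
-- and of the last m − 1 rows of B. Stacked, they list the m rows of B, so they factor through B
-- but through nothing narrower (m unimodular vectors never fit in a module generated by fewer
-- vectors: count the elements), and once B is in reduced echelon form they have a unit m × m minor
-- while all larger minors repeat a row. A subspace containing P₁ and P₂ contains A, and one of
-- dimension at most m containing A is A. Conversely, if P₁ and P₂ are Mc-adjacent, their stacked
-- bases factor as C D with D of m rows. Over the local ring ℤ/pˢ the rows of D lie in the span of
-- at most m unimodular vectors (divide by p and project until an entry is a unit), so the join has
-- dimension at most m; it is at least m since the stacked bases also factor through a basis of the join.

open import Defs
open import Data.Nat using (ℕ; suc; _^_; _≤_; _<_; _∸_)
open import Data.Nat.Primality using (Prime)
open import Data.Product using (∃-syntax; _×_)
open import Relation.Binary.PropositionalEquality using (_≡_)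
open import Function.Bundles using (_⇔_)

open import Algebra.Bundles using (CommutativeRing)
import Algebra.Properties.CommutativeSemigroup as CommSemigroupProperties
import Algebra.Properties.Ring as RingProperties
import Algebra.Solver.CommutativeMonoid as CommMonoidSolver
open import Data.Empty using (⊥-elim)
open import Data.Fin as Fin
  using (Fin; toℕ; punchIn; punchOut; inject₁; splitAt; _↑ˡ_; _↑ʳ_; combine; remQuot)
  renaming (zero to fzero; suc to fsuc)
open import Data.Fin.Properties
  using (toℕ-fromℕ<; toℕ-injective; toℕ<n; punchInᵢ≢i; punchOut-punchIn; punchOut-cong;
         punchOut-injective; suc-injective; inject₁-injective; splitAt-↑ʳ;
         combine-injective; combine-remQuot; injective⇒≤; any?; all?; pigeonhole; <⇒≢)
  renaming (_≟_ to _≟ᶠ_)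
open import Data.Nat as ℕ using (zero; z≤n; s≤s; _%_; NonZero)
import Data.Nat.Properties as ℕ
open import Data.Nat.DivMod
  using (m<n⇒m%n≡m; m≤n⇒m%n≡m; %-distribˡ-+; %-distribˡ-*; n%n≡0; m∣n⇒o%n%m≡o%m; _mod_)
open import Data.Nat.Divisibility
  using (_∣_; _∣?_; divides; m%n≡0⇒n∣m; n∣m⇒m%n≡0; ∣1⇒≡1; m∣m*n; ∣m∣n⇒∣m+n; ∣m⇒∣m*n; _∣0; 1∣_; m*n∣⇒m∣; *-monoʳ-∣;
         *-cancelˡ-∣)
open import Data.Nat.Primality using (prime⇒nonZero; prime⇒nonTrivial; euclidsLemma)
open import Data.Product using (Σ; _,_; proj₁; proj₂)
open import Data.Sum using (_⊎_; inj₁; inj₂; [_,_]′)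
open import Data.Vec.Functional using (_++_; _∷_; init; tail)
open import Data.Vec.Functional.Properties using (lookup-++ˡ; lookup-++ʳ)
open import Function.Base using (_∘_)
open import Function.Bundles using (mk⇔; Equivalence)
open import Function.Definitions using (Injective)
open import Level using (0ℓ)
open import Relation.Binary.PropositionalEquality
  using (_≢_; _≗_; refl; sym; trans; cong; cong₂; subst; isEquivalence; module ≡-Reasoning)
open import Relation.Nullary using (¬_; Dec; yes; no; ¬?)
open import Relation.Nullary.Decidable using (decidable-stable)

module Residues {k : ℕ} where

  open ≡-Reasoning

  reduce : ℕ → ℤq k
  reduce m = m mod suc k

  toℕ-reduce : ∀ m → toℕ (reduce m) ≡ m % suc k
  toℕ-reduce m = toℕ-fromℕ< _

  reduce-toℕ : (a : ℤq k) → reduce (toℕ a) ≡ a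
  reduce-toℕ a = toℕ-injective (trans (toℕ-reduce (toℕ a)) (m<n⇒m%n≡m (toℕ<n a)))

  reduce-cong : ∀ m n → m % suc k ≡ n % suc k → reduce m ≡ reduce n
  reduce-cong m n e = toℕ-injective (trans (toℕ-reduce m) (trans e (sym (toℕ-reduce n))))

  reduce-+ : ∀ m n → reduce (m ℕ.+ n) ≡ reduce m +ᵣ reduce n
  reduce-+ m n = reduce-cong (m ℕ.+ n) (toℕ (reduce m) ℕ.+ toℕ (reduce n)) (begin
    (m ℕ.+ n) % suc k                              ≡⟨ %-distribˡ-+ m n (suc k) ⟩
    (m % suc k ℕ.+ n % suc k) % suc k              ≡⟨ cong₂ (λ a b → (a ℕ.+ b) % suc k) (toℕ-reduce m) (toℕ-reduce n) ⟨
    (toℕ (reduce m) ℕ.+ toℕ (reduce n)) % suc k    ∎)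

  reduce-* : ∀ m n → reduce (m ℕ.* n) ≡ reduce m *ᵣ reduce n
  reduce-* m n = reduce-cong (m ℕ.* n) (toℕ (reduce m) ℕ.* toℕ (reduce n)) (begin
    (m ℕ.* n) % suc k                              ≡⟨ %-distribˡ-* m n (suc k) ⟩
    (m % suc k ℕ.* (n % suc k)) % suc k            ≡⟨ cong₂ (λ a b → (a ℕ.* b) % suc k) (toℕ-reduce m) (toℕ-reduce n) ⟨
    (toℕ (reduce m) ℕ.* toℕ (reduce n)) % suc k    ∎)

  -- Every law is an identity of ℕ transported along the homomorphism  reduce.
  +-assocᵣ : ∀ a b c → (a +ᵣ b) +ᵣ c ≡ a +ᵣ (b +ᵣ c)
  +-assocᵣ a b c = begin
    reduce (toℕ a ℕ.+ toℕ b) +ᵣ c                  ≡⟨ cong (reduce (toℕ a ℕ.+ toℕ b) +ᵣ_) (reduce-toℕ c) ⟨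
    reduce (toℕ a ℕ.+ toℕ b) +ᵣ reduce (toℕ c)     ≡⟨ reduce-+ (toℕ a ℕ.+ toℕ b) (toℕ c) ⟨
    reduce (toℕ a ℕ.+ toℕ b ℕ.+ toℕ c)             ≡⟨ cong reduce (ℕ.+-assoc (toℕ a) _ _) ⟩
    reduce (toℕ a ℕ.+ (toℕ b ℕ.+ toℕ c))           ≡⟨ reduce-+ (toℕ a) _ ⟩
    reduce (toℕ a) +ᵣ (b +ᵣ c)                     ≡⟨ cong (_+ᵣ (b +ᵣ c)) (reduce-toℕ a) ⟩
    a +ᵣ (b +ᵣ c)                                  ∎

  *-assocᵣ : ∀ a b c → (a *ᵣ b) *ᵣ c ≡ a *ᵣ (b *ᵣ c)
  *-assocᵣ a b c = begin
    reduce (toℕ a ℕ.* toℕ b) *ᵣ c                  ≡⟨ cong (reduce (toℕ a ℕ.* toℕ b) *ᵣ_) (reduce-toℕ c) ⟨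
    reduce (toℕ a ℕ.* toℕ b) *ᵣ reduce (toℕ c)     ≡⟨ reduce-* (toℕ a ℕ.* toℕ b) (toℕ c) ⟨
    reduce (toℕ a ℕ.* toℕ b ℕ.* toℕ c)             ≡⟨ cong reduce (ℕ.*-assoc (toℕ a) _ _) ⟩
    reduce (toℕ a ℕ.* (toℕ b ℕ.* toℕ c))           ≡⟨ reduce-* (toℕ a) _ ⟩
    reduce (toℕ a) *ᵣ (b *ᵣ c)                     ≡⟨ cong (_*ᵣ (b *ᵣ c)) (reduce-toℕ a) ⟩
    a *ᵣ (b *ᵣ c)                                  ∎

  +-commᵣ : ∀ a b → a +ᵣ b ≡ b +ᵣ a
  +-commᵣ a b = cong reduce (ℕ.+-comm (toℕ a) (toℕ b))

  *-commᵣ : ∀ a b → a *ᵣ b ≡ b *ᵣ a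
  *-commᵣ a b = cong reduce (ℕ.*-comm (toℕ a) (toℕ b))

  +-identityˡᵣ : ∀ a → 0ᵣ +ᵣ a ≡ a
  +-identityˡᵣ = reduce-toℕ

  *-identityˡᵣ : ∀ a → 1ᵣ *ᵣ a ≡ a
  *-identityˡᵣ a = begin
    1ᵣ *ᵣ a                                        ≡⟨ cong (reduce 1 *ᵣ_) (reduce-toℕ a) ⟨
    reduce 1 *ᵣ reduce (toℕ a)                     ≡⟨ reduce-* 1 (toℕ a) ⟨
    reduce (1 ℕ.* toℕ a)                           ≡⟨ cong reduce (ℕ.*-identityˡ (toℕ a)) ⟩
    reduce (toℕ a)                                 ≡⟨ reduce-toℕ a ⟩
    a                                              ∎

  *-distribˡ-+ᵣ : ∀ a b c → a *ᵣ (b +ᵣ c) ≡ a *ᵣ b +ᵣ a *ᵣ c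
  *-distribˡ-+ᵣ a b c = begin
    a *ᵣ (b +ᵣ c)                                  ≡⟨ cong (_*ᵣ (b +ᵣ c)) (reduce-toℕ a) ⟨
    reduce (toℕ a) *ᵣ reduce (toℕ b ℕ.+ toℕ c)     ≡⟨ reduce-* (toℕ a) _ ⟨
    reduce (toℕ a ℕ.* (toℕ b ℕ.+ toℕ c))           ≡⟨ cong reduce (ℕ.*-distribˡ-+ (toℕ a) _ _) ⟩
    reduce (toℕ a ℕ.* toℕ b ℕ.+ toℕ a ℕ.* toℕ c)   ≡⟨ reduce-+ (toℕ a ℕ.* toℕ b) _ ⟩
    a *ᵣ b +ᵣ a *ᵣ c                               ∎

  -‿inverseˡᵣ : ∀ a → (-ᵣ a) +ᵣ a ≡ 0ᵣ
  -‿inverseˡᵣ a = begin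
    (-ᵣ a) +ᵣ a                                    ≡⟨ cong ((-ᵣ a) +ᵣ_) (reduce-toℕ a) ⟨
    reduce (suc k ∸ toℕ a) +ᵣ reduce (toℕ a)       ≡⟨ reduce-+ (suc k ∸ toℕ a) (toℕ a) ⟨
    reduce (suc k ∸ toℕ a ℕ.+ toℕ a)               ≡⟨ cong reduce (ℕ.m∸n+n≡m (ℕ.<⇒≤ (toℕ<n a))) ⟩
    reduce (suc k)                                 ≡⟨ reduce-cong (suc k) 0 (n%n≡0 (suc k)) ⟩
    0ᵣ                                             ∎

  ℤq-commutativeRing : CommutativeRing 0ℓ 0ℓ
  ℤq-commutativeRing = record
    { Carrier = ℤq k ; _≈_ = _≡_ ; _+_ = _+ᵣ_ ; _*_ = _*ᵣ_ ; -_ = -ᵣ_ ; 0# = 0ᵣ ; 1# = 1ᵣ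
    ; isCommutativeRing = record
      { isRing = record
        { +-isAbelianGroup = record
          { isGroup = record
            { isMonoid = record
              { isSemigroup = record
                { isMagma = record { isEquivalence = isEquivalence ; ∙-cong = cong₂ _+ᵣ_ }
                ; assoc = +-assocᵣ }
              ; identity = +-identityˡᵣ , λ a → trans (+-commᵣ a 0ᵣ) (+-identityˡᵣ a) }
            ; inverse = -‿inverseˡᵣ , λ a → trans (+-commᵣ a _) (-‿inverseˡᵣ a)
            ; ⁻¹-cong = cong -ᵣ_ }
          ; comm = +-commᵣ }
        ; *-cong = cong₂ _*ᵣ_
        ; *-assoc = *-assocᵣ
        ; *-identity = *-identityˡᵣ , λ a → trans (*-commᵣ a 1ᵣ) (*-identityˡᵣ a)
        ; distrib = *-distribˡ-+ᵣ
                  , λ a b c → trans (*-commᵣ _ a)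
                                (trans (*-distribˡ-+ᵣ a b c) (cong₂ _+ᵣ_ (*-commᵣ a b) (*-commᵣ a c))) }
      ; *-comm = *-commᵣ } }

open Residues using (reduce; toℕ-reduce; reduce-toℕ; reduce-cong; reduce-+; reduce-*; ℤq-commutativeRing)

module _ {k : ℕ} where
  open CommutativeRing (ℤq-commutativeRing {k}) public
    using (+-assoc; +-comm; *-assoc; *-comm; zeroˡ; zeroʳ; distribˡ; distribʳ; *-identityˡ; *-identityʳ;
           +-identityˡ; +-identityʳ; -‿inverseˡ; -‿inverseʳ)
  open CommutativeRing (ℤq-commutativeRing {k}) using (ring; *-commutativeSemigroup; +-commutativeSemigroup)
  open RingProperties ring public
    using (-‿distribˡ-*; -‿distribʳ-*; -‿involutive; -‿injective; -0#≈0#; -‿+-comm; //-rightDividesˡ;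
           x∙y⁻¹≈ε⇒x≈y; x[y-z]≈xy-xz)
  open CommSemigroupProperties *-commutativeSemigroup public using (x∙yz≈y∙xz)
  open CommSemigroupProperties +-commutativeSemigroup public using (interchange)
    renaming (x∙yz≈y∙xz to x+[y+z]≡y+[x+z])

module _ {k : ℕ} where

  open ≡-Reasoning

  sum-cong : ∀ {j} {f g : Fin j → ℤq k} → f ≗ g → Σᵣ f ≡ Σᵣ g
  sum-cong {zero}  f≗g = refl
  sum-cong {suc j} f≗g = cong₂ _+ᵣ_ (f≗g fzero) (sum-cong (f≗g ∘ fsuc))

  sum-zero : ∀ {j} {f : Fin j → ℤq k} → (∀ i → f i ≡ 0ᵣ) → Σᵣ f ≡ 0ᵣ
  sum-zero {zero}  f≗0 = refl
  sum-zero {suc j} f≗0 = trans (cong₂ _+ᵣ_ (f≗0 fzero) (sum-zero (f≗0 ∘ fsuc))) (+-identityˡ 0ᵣ)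

  sum-distrib-+ : ∀ {j} (f g : Fin j → ℤq k) → Σᵣ (λ i → f i +ᵣ g i) ≡ Σᵣ f +ᵣ Σᵣ g
  sum-distrib-+ {zero}  f g = sym (+-identityˡ 0ᵣ)
  sum-distrib-+ {suc j} f g = trans (cong (f fzero +ᵣ g fzero +ᵣ_) (sum-distrib-+ (f ∘ fsuc) (g ∘ fsuc)))
                                    (interchange (f fzero) (g fzero) (Σᵣ (f ∘ fsuc)) (Σᵣ (g ∘ fsuc)))

  *-distribˡ-sum : ∀ {j} (a : ℤq k) (f : Fin j → ℤq k) → a *ᵣ Σᵣ f ≡ Σᵣ (λ i → a *ᵣ f i)
  *-distribˡ-sum {zero}  a f = zeroʳ a
  *-distribˡ-sum {suc j} a f = trans (distribˡ a (f fzero) (Σᵣ (f ∘ fsuc))) (cong (a *ᵣ f fzero +ᵣ_) (*-distribˡ-sum a (f ∘ fsuc)))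

  *-distribʳ-sum : ∀ {j} (a : ℤq k) (f : Fin j → ℤq k) → Σᵣ f *ᵣ a ≡ Σᵣ (λ i → f i *ᵣ a)
  *-distribʳ-sum a f = trans (*-comm (Σᵣ f) a) (trans (*-distribˡ-sum a f) (sum-cong (λ i → *-comm a (f i))))

  sum-comm : ∀ {a b} (f : Fin a → Fin b → ℤq k) → Σᵣ (λ i → Σᵣ (f i)) ≡ Σᵣ (λ j → Σᵣ (λ i → f i j))
  sum-comm {zero} {b} f = sym (sum-zero {b} (λ _ → refl))
  sum-comm {suc a} f = begin
    Σᵣ (f fzero) +ᵣ Σᵣ (λ i → Σᵣ (f (fsuc i)))              ≡⟨ cong (Σᵣ (f fzero) +ᵣ_) (sum-comm (f ∘ fsuc)) ⟩
    Σᵣ (f fzero) +ᵣ Σᵣ (λ j → Σᵣ (λ i → f (fsuc i) j))      ≡⟨ sum-distrib-+ (f fzero) (λ j → Σᵣ (λ i → f (fsuc i) j)) ⟨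
    Σᵣ (λ j → f fzero j +ᵣ Σᵣ (λ i → f (fsuc i) j))         ∎

  sum-remove : ∀ {j} (i : Fin (suc j)) (f : Fin (suc j) → ℤq k) → Σᵣ f ≡ f i +ᵣ Σᵣ (f ∘ punchIn i)
  sum-remove         fzero    f = refl
  sum-remove {suc j} (fsuc i) f = trans (cong (f fzero +ᵣ_) (sum-remove i (f ∘ fsuc)))
                                        (x+[y+z]≡y+[x+z] (f fzero) (f (fsuc i)) (Σᵣ (f ∘ fsuc ∘ punchIn i)))

  sum-neg : ∀ {j} (f : Fin j → ℤq k) → Σᵣ (λ i → -ᵣ f i) ≡ -ᵣ Σᵣ f
  sum-neg {zero}  f = sym -0#≈0#
  sum-neg {suc j} f = trans (cong ((-ᵣ f fzero) +ᵣ_) (sum-neg (f ∘ fsuc))) (-‿+-comm (f fzero) (Σᵣ (f ∘ fsuc)))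

  sum-single : ∀ {j} (i : Fin j) (f : Fin j → ℤq k) → (∀ l → l ≢ i → f l ≡ 0ᵣ) → Σᵣ f ≡ f i
  sum-single {suc j} i f f≗0 = begin
    Σᵣ f                        ≡⟨ sum-remove i f ⟩
    f i +ᵣ Σᵣ (f ∘ punchIn i)   ≡⟨ cong (f i +ᵣ_) (sum-zero (λ l → f≗0 (punchIn i l) (punchInᵢ≢i i l))) ⟩
    f i +ᵣ 0ᵣ                   ≡⟨ +-identityʳ (f i) ⟩
    f i                         ∎

  idMat-diag : ∀ {a} (i : Fin a) → idMat {k} i i ≡ 1ᵣ
  idMat-diag i with i ≟ᶠ i
  ... | yes _  = refl
  ... | no i≢i = ⊥-elim (i≢i refl)

  idMat-≢ : ∀ {a} {i j : Fin a} → i ≢ j → idMat {k} i j ≡ 0ᵣ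
  idMat-≢ {i = i} {j} i≢j with i ≟ᶠ j
  ... | yes i≡j = ⊥-elim (i≢j i≡j)
  ... | no _    = refl

  idMat-reindex : ∀ {a b} (h : Fin a → Fin b) → Injective _≡_ _≡_ h →
                  ∀ i j → idMat {k} (h i) (h j) ≡ idMat i j
  idMat-reindex h h-inj i j with i ≟ᶠ j
  ... | yes refl = idMat-diag (h i)
  ... | no i≢j   = idMat-≢ (i≢j ∘ h-inj)

  idMat-sym : ∀ {a} (i j : Fin a) → idMat {k} i j ≡ idMat j i
  idMat-sym i j with i ≟ᶠ j
  ... | yes refl = sym (idMat-diag i)
  ... | no i≢j   = sym (idMat-≢ (i≢j ∘ sym))

  sum-idMatˡ : ∀ {a} (i : Fin a) (f : Fin a → ℤq k) → Σᵣ (λ j → idMat i j *ᵣ f j) ≡ f i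
  sum-idMatˡ i f = begin
    Σᵣ (λ j → idMat i j *ᵣ f j)  ≡⟨ sum-single i _ (λ j j≢i → trans (cong (_*ᵣ f j) (idMat-≢ (j≢i ∘ sym))) (zeroˡ (f j))) ⟩
    idMat i i *ᵣ f i             ≡⟨ cong (_*ᵣ f i) (idMat-diag i) ⟩
    1ᵣ *ᵣ f i                    ≡⟨ *-identityˡ (f i) ⟩
    f i                          ∎

  sum-idMatʳ : ∀ {a} (i : Fin a) (f : Fin a → ℤq k) → Σᵣ (λ j → f j *ᵣ idMat j i) ≡ f i
  sum-idMatʳ i f = trans (sum-cong (λ j → trans (*-comm (f j) _) (cong (_*ᵣ f j) (idMat-sym j i)))) (sum-idMatˡ i f)

  infixl 6 _-ᵥ_

  _-ᵥ_ : ∀ {n} → Vect k n → Vect k n → Vect k n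
  (u -ᵥ v) l = u l +ᵣ (-ᵣ v l)

  comb-congˡ : ∀ {a n} {c c′ : Fin a → ℤq k} (M : Mat k a n) → c ≗ c′ → comb c M ≗ comb c′ M
  comb-congˡ M c≗c′ j = sum-cong (λ i → cong (_*ᵣ M i j) (c≗c′ i))

  comb-congʳ : ∀ {a n} (c : Fin a → ℤq k) {M M′ : Mat k a n} → M ≈ₘ M′ → comb c M ≗ comb c M′
  comb-congʳ c M≈M′ j = sum-cong (λ i → cong (c i *ᵣ_) (M≈M′ i j))

  comb-assoc : ∀ {a b n} (c : Fin a → ℤq k) (M : Mat k a b) (N : Mat k b n) →
               comb (comb c M) N ≗ comb c (M · N)
  comb-assoc c M N j = begin
    Σᵣ (λ l → Σᵣ (λ i → c i *ᵣ M i l) *ᵣ N l j)      ≡⟨ sum-cong (λ l → *-distribʳ-sum (N l j) (λ i → c i *ᵣ M i l)) ⟩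
    Σᵣ (λ l → Σᵣ (λ i → (c i *ᵣ M i l) *ᵣ N l j))    ≡⟨ sum-comm (λ l i → (c i *ᵣ M i l) *ᵣ N l j) ⟩
    Σᵣ (λ i → Σᵣ (λ l → (c i *ᵣ M i l) *ᵣ N l j))    ≡⟨ sum-cong (λ i → sum-cong (λ l → *-assoc (c i) (M i l) (N l j))) ⟩
    Σᵣ (λ i → Σᵣ (λ l → c i *ᵣ (M i l *ᵣ N l j)))    ≡⟨ sum-cong (λ i → *-distribˡ-sum (c i) (λ l → M i l *ᵣ N l j)) ⟨
    Σᵣ (λ i → c i *ᵣ Σᵣ (λ l → M i l *ᵣ N l j))      ∎

  comb-idMat : ∀ {a} (c : Fin a → ℤq k) → comb c idMat ≗ c
  comb-idMat c j = sum-idMatʳ j c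

  comb-row : ∀ {a n} (i : Fin a) (M : Mat k a n) → comb (idMat i) M ≗ M i
  comb-row i M j = sum-idMatˡ i (λ l → M l j)

  comb-+ : ∀ {a n} (c c′ : Fin a → ℤq k) (M : Mat k a n) →
           comb (λ i → c i +ᵣ c′ i) M ≗ (λ j → comb c M j +ᵣ comb c′ M j)
  comb-+ c c′ M j = trans (sum-cong (λ i → distribʳ (M i j) (c i) (c′ i)))
                          (sum-distrib-+ (λ i → c i *ᵣ M i j) (λ i → c′ i *ᵣ M i j))

  comb-* : ∀ {a n} (r : ℤq k) (c : Fin a → ℤq k) (M : Mat k a n) →
           comb (λ i → r *ᵣ c i) M ≗ (λ j → r *ᵣ comb c M j)
  comb-* r c M j = trans (sum-cong (λ i → *-assoc r (c i) (M i j))) (sym (*-distribˡ-sum r (λ i → c i *ᵣ M i j)))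

  comb-sub : ∀ {a n} (c c′ : Fin a → ℤq k) (M : Mat k a n) → comb (c -ᵥ c′) M ≗ comb c M -ᵥ comb c′ M
  comb-sub c c′ M j = begin
    comb (c -ᵥ c′) M j                           ≡⟨ comb-+ c (λ i → -ᵣ c′ i) M j ⟩
    comb c M j +ᵣ comb (λ i → -ᵣ c′ i) M j       ≡⟨ cong (comb c M j +ᵣ_) (sum-cong (λ i → -‿distribˡ-* (c′ i) (M i j))) ⟨
    comb c M j +ᵣ Σᵣ (λ i → -ᵣ (c′ i *ᵣ M i j))  ≡⟨ cong (comb c M j +ᵣ_) (sum-neg (λ i → c′ i *ᵣ M i j)) ⟩
    (comb c M -ᵥ comb c′ M) j                    ∎

  comb-zeroˡ : ∀ {a n} (M : Mat k a n) → comb (λ _ → 0ᵣ) M ≗ (λ _ → 0ᵣ)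
  comb-zeroˡ M j = sum-zero (λ i → zeroˡ (M i j))

module _ {k : ℕ} where

  open ≡-Reasoning

  rowSpan-resp : ∀ {a n} (M : Mat k a n) {u v : Vect k n} → u ≗ v → RowSpan M u → RowSpan M v
  rowSpan-resp M u≗v (c , u≗cM) = c , λ j → trans (sym (u≗v j)) (u≗cM j)

  rowSpan-row : ∀ {a n} (M : Mat k a n) (i : Fin a) → RowSpan M (M i)
  rowSpan-row M i = idMat i , λ j → sym (comb-row i M j)

  rowSpan-comb : ∀ {a b n} (M : Mat k a n) (N : Mat k b n) → (∀ i → RowSpan M (N i)) →
                 ∀ c → RowSpan M (comb c N)
  rowSpan-comb M N N⊆M c = comb c C , λ j → begin
      comb c N j            ≡⟨ comb-congʳ c (λ i → proj₂ (N⊆M i)) j ⟩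
      comb c (C · M) j      ≡⟨ comb-assoc c C M j ⟨
      comb (comb c C) M j   ∎
    where
    C = λ i → proj₁ (N⊆M i)

  rowSpan-⊆ : ∀ {a b n} (M : Mat k a n) (N : Mat k b n) → (∀ i → RowSpan M (N i)) → RowSpan N ⊆ RowSpan M
  rowSpan-⊆ M N N⊆M v (c , v≗cN) = rowSpan-resp M (sym ∘ v≗cN) (rowSpan-comb M N N⊆M c)

  rowSpan-+ : ∀ {a n} (M : Mat k a n) {u v : Vect k n} →
              RowSpan M u → RowSpan M v → RowSpan M (λ l → u l +ᵣ v l)
  rowSpan-+ M (c , u≗cM) (c′ , v≗c′M) =
    (λ i → c i +ᵣ c′ i) , λ j → trans (cong₂ _+ᵣ_ (u≗cM j) (v≗c′M j)) (sym (comb-+ c c′ M j))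

  rowSpan-* : ∀ {a n} (M : Mat k a n) (r : ℤq k) {u : Vect k n} → RowSpan M u → RowSpan M (λ l → r *ᵣ u l)
  rowSpan-* M r (c , u≗cM) = (λ i → r *ᵣ c i) , λ j → trans (cong (r *ᵣ_) (u≗cM j)) (sym (comb-* r c M j))

  rowSpan-sub : ∀ {a n} (M : Mat k a n) {u v : Vect k n} → RowSpan M u → RowSpan M v → RowSpan M (u -ᵥ v)
  rowSpan-sub M (c , u≗cM) (c′ , v≗c′M) =
    c -ᵥ c′ , λ j → trans (cong₂ (λ x y → x +ᵣ (-ᵣ y)) (u≗cM j) (v≗c′M j)) (sym (comb-sub c c′ M j))

  rowSpan-isSubmodule : ∀ {a n} (M : Mat k a n) → IsSubmodule (RowSpan M)
  rowSpan-isSubmodule M = ((λ _ → 0ᵣ) , λ j → sym (comb-zeroˡ M j))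
                        , (λ _ _ → rowSpan-+ M)
                        , (λ r _ → rowSpan-* M r)

  comb-cancel : ∀ {a n} (U : Mat k a n) (N : Mat k n a) → (U · N) ≈ₘ idMat → ∀ c → comb (comb c U) N ≗ c
  comb-cancel U N UN≈I c j = begin
    comb (comb c U) N j   ≡⟨ comb-assoc c U N j ⟩
    comb c (U · N) j      ≡⟨ comb-congʳ c UN≈I j ⟩
    comb c idMat j        ≡⟨ comb-idMat c j ⟩
    c j                   ∎

  unimodular⇒linIndep : ∀ {a n} (M : Mat k a n) → Unimodular M → LinIndep M
  unimodular⇒linIndep M (N , MN≈I) c cM≗0 i = begin
    c i                   ≡⟨ comb-cancel M N MN≈I c i ⟨
    comb (comb c M) N i   ≡⟨ comb-congˡ N cM≗0 i ⟩
    comb (λ _ → 0ᵣ) N i   ≡⟨ comb-zeroˡ N i ⟩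
    0ᵣ                    ∎

  rowSpan-isBasis : ∀ {a n} (M : Mat k a n) → Unimodular M → IsBasis M (RowSpan M)
  rowSpan-isBasis M M-unimodular = (λ _ → mk⇔ (λ x → x) (λ x → x)) , unimodular⇒linIndep M M-unimodular

  rowSpan-isSubspace : ∀ {a n} (M : Mat k a n) → Unimodular M → IsSubspace a (RowSpan M)
  rowSpan-isSubspace M M-unimodular = rowSpan-isSubmodule M , M , M-unimodular , rowSpan-isBasis M M-unimodular

  unimodular-reindex : ∀ {a b n} (M : Mat k b n) (h : Fin a → Fin b) → Injective _≡_ _≡_ h →
                       Unimodular M → Unimodular (M ∘ h)
  unimodular-reindex M h h-inj (N , MN≈I) =
    (λ l j → N l (h j)) , λ i j → trans (MN≈I (h i) (h j)) (idMat-reindex h h-inj i j)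

  subspace-⊇-rowSpan : ∀ {d a n} {Z : Subset k n} → IsSubspace d Z → (B : Mat k a n) → (∀ i → Z (B i)) → RowSpan B ⊆ Z
  subspace-⊇-rowSpan (_ , M , _ , Z⇔M , _) B B⊆Z v v∈B =
    Equivalence.from (Z⇔M v) (rowSpan-⊆ M B (λ i → Equivalence.to (Z⇔M (B i)) (B⊆Z i)) v v∈B)

  subspace-resp-≐ : ∀ {d n} {V W : Subset k n} → V ≐ W → IsSubspace d W → IsSubspace d V
  subspace-resp-≐ V≐W ((W0 , W+ , W*) , M , M-unimodular , W⇔M , M-indep) =
    ( from 0v W0
    , (λ u v Vu Vv → from _ (W+ u v (to u Vu) (to v Vv)))
    , (λ r v Vv → from _ (W* r v (to v Vv))) )
    , M , M-unimodular
    , (λ v → mk⇔ (Equivalence.to (W⇔M v) ∘ to v) (from v ∘ Equivalence.from (W⇔M v)))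
    , M-indep
    where
    0v = λ _ → 0ᵣ
    to = λ v → Equivalence.to (V≐W v)
    from = λ v → Equivalence.from (V≐W v)

-- Counting and dimension

module _ {q : ℕ} where

  encode : ∀ {d} → (Fin d → Fin q) → Fin (q ^ d)
  encode {zero}  v = fzero
  encode {suc d} v = combine {q} {q ^ d} (v fzero) (encode (v ∘ fsuc))

  decode : ∀ {d} → Fin (q ^ d) → Fin d → Fin q
  decode {suc d} i fzero    = proj₁ (remQuot {q} (q ^ d) i)
  decode {suc d} i (fsuc j) = decode (proj₂ (remQuot {q} (q ^ d) i)) j

  encode-cong : ∀ {d} {u v : Fin d → Fin q} → u ≗ v → encode u ≡ encode v
  encode-cong {zero}  u≗v = refl
  encode-cong {suc d} u≗v = cong₂ combine (u≗v fzero) (encode-cong (u≗v ∘ fsuc))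

  encode-injective : ∀ {d} {u v : Fin d → Fin q} → encode u ≡ encode v → u ≗ v
  encode-injective {suc d} {u} {v} eq fzero    = proj₁ (combine-injective (u fzero) _ (v fzero) _ eq)
  encode-injective {suc d} {u} {v} eq (fsuc j) = encode-injective (proj₂ (combine-injective (u fzero) _ (v fzero) _ eq)) j

  encode-decode : ∀ {d} (i : Fin (q ^ d)) → encode (decode {d} i) ≡ i
  encode-decode {zero}  fzero = refl
  encode-decode {suc d} i =
    trans (cong (combine {q} {q ^ d} _) (encode-decode {d} (proj₂ (remQuot {q} (q ^ d) i)))) (combine-remQuot {q} (q ^ d) i)

fin-injective⇒surjective : ∀ {a b} (F : Fin a → Fin b) → Injective _≡_ _≡_ F → b ≤ a → ∀ y → ∃[ i ] F i ≡ y
fin-injective⇒surjective {a} {b} F F-inj b≤a y with any? (λ i → F i ≟ᶠ y)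
... | yes hit = hit
fin-injective⇒surjective {a} {suc b} F F-inj b≤a y | no miss =
  ⊥-elim (ℕ.<-irrefl refl (ℕ.≤-trans b≤a (injective⇒≤ {f = F′} F′-inj)))
  where
  F≢y : ∀ i → F i ≢ y
  F≢y i Fi≡y = miss (i , Fi≡y)
  F′ : Fin a → Fin b
  F′ i = punchOut (F≢y i ∘ sym)
  F′-inj : Injective _≡_ _≡_ F′
  F′-inj {i} {j} eq = F-inj (punchOut-injective (F≢y i ∘ sym) (F≢y j ∘ sym) eq)

module _ {k : ℕ} (1≤k : 1 ≤ k) {d r : ℕ} (φ : Vect k d → Vect k r) (φ-inj : ∀ u v → φ u ≗ φ v → u ≗ v) where

  private
    F : Fin (suc k ^ d) → Fin (suc k ^ r)
    F = encode ∘ φ ∘ decode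

    F-inj : Injective _≡_ _≡_ F
    F-inj {i} {j} eq =
      trans (sym (encode-decode {suc k} {d} i))
            (trans (encode-cong (φ-inj (decode i) (decode j) (encode-injective eq))) (encode-decode {suc k} {d} j))

  vectInjection⇒≤ : d ≤ r
  vectInjection⇒≤ with d ℕ.≤? r
  ... | yes d≤r = d≤r
  ... | no d≰r = ⊥-elim (ℕ.<⇒≱ (ℕ.^-monoʳ-< (suc k) (s≤s 1≤k) (ℕ.≰⇒> d≰r)) (injective⇒≤ F-inj))

  vectInjection⇒surjective : r ≤ d → ∀ y → ∃[ x ] φ x ≗ y
  vectInjection⇒surjective r≤d y with fin-injective⇒surjective F F-inj (ℕ.^-monoʳ-≤ (suc k) r≤d) (encode y)
  ... | i , Fi≡y = decode i , encode-injective Fi≡y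

module _ {k : ℕ} (1≤k : 1 ≤ k) where

  open ≡-Reasoning

  toℕ-1ᵣ : toℕ (1ᵣ {k}) ≡ 1
  toℕ-1ᵣ = trans (toℕ-reduce 1) (m≤n⇒m%n≡m 1≤k)

  1ᵣ≢0ᵣ : 1ᵣ {k} ≢ 0ᵣ
  1ᵣ≢0ᵣ 1≡0 = ℕ.1+n≢0 (trans (sym toℕ-1ᵣ) (cong toℕ 1≡0))

  unimodular⇒injective : ∀ {a n} (M : Mat k a n) → Unimodular M → Injective _≡_ _≡_ M
  unimodular⇒injective M (N , MN≈I) {i} {j} Mi≡Mj with i ≟ᶠ j
  ... | yes i≡j = i≡j
  ... | no i≢j  = ⊥-elim (1ᵣ≢0ᵣ (begin
    1ᵣ            ≡⟨ idMat-diag i ⟨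
    idMat i i     ≡⟨ MN≈I i i ⟨
    (M · N) i i   ≡⟨ cong (λ u → comb u N i) Mi≡Mj ⟩
    (M · N) j i   ≡⟨ MN≈I j i ⟩
    idMat j i     ≡⟨ idMat-≢ (i≢j ∘ sym) ⟩
    0ᵣ            ∎))

  coefficients-injective : ∀ {d r n} (U : Mat k d n) → Unimodular U → (M : Mat k r n) (C : Mat k d r) →
                           U ≈ₘ (C · M) → ∀ x y → comb x C ≗ comb y C → x ≗ y
  coefficients-injective U (N , UN≈I) M C U≈CM x y xC≗yC j =
    trans (sym (recover x j)) (trans (comb-congˡ N (comb-congˡ M xC≗yC) j) (recover y j))
    where
    recover : ∀ x → comb (comb (comb x C) M) N ≗ x
    recover x j = begin
      comb (comb (comb x C) M) N j  ≡⟨ comb-congˡ N (λ l → trans (comb-assoc x C M l) (sym (comb-congʳ x U≈CM l))) j ⟩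
      comb (comb x U) N j           ≡⟨ comb-cancel U N UN≈I x j ⟩
      x j                           ∎

  unimodular-in-span⇒≤ : ∀ {d r n} (U : Mat k d n) (M : Mat k r n) → Unimodular U →
                         (∀ i → RowSpan M (U i)) → d ≤ r
  unimodular-in-span⇒≤ U M U-unimodular U⊆M =
    vectInjection⇒≤ 1≤k _ (coefficients-injective U U-unimodular M (proj₁ ∘ U⊆M) (proj₂ ∘ U⊆M))

  subspace⇒hasDim : ∀ {d n} {V : Subset k n} → IsSubspace d V → HasDim V d
  subspace⇒hasDim (_ , M , M-unimodular , V⇔M , _) =
      (M , M-unimodular , unimodular⇒injective M M-unimodular , λ i → Equivalence.from (V⇔M (M i)) (rowSpan-row M i))
    , λ d′ (U , U-unimodular , _ , U⊆V) →
        unimodular-in-span⇒≤ U M U-unimodular (λ i → Equivalence.to (V⇔M (U i)) (U⊆V i))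

  hasDim-unique : ∀ {n} {V : Subset k n} {d d′} → HasDim V d → HasDim V d′ → d ≡ d′
  hasDim-unique (V⊇d , d-max) (V⊇d′ , d′-max) = ℕ.≤-antisym (d′-max _ V⊇d) (d-max _ V⊇d′)

  -- The coordinate map of A into ℤq^d is injective, hence surjective by counting.
  subspace-⊆⇒⊇ : ∀ {m d n} {A Z : Subset k n} → IsSubspace m A → IsSubspace d Z → A ⊆ Z → d ≤ m → Z ⊆ A
  subspace-⊆⇒⊇ (_ , B , B-unimodular , A⇔B , _) (_ , M , _ , Z⇔M , _) A⊆Z d≤m z Zz =
    Equivalence.from (A⇔B z) (rowSpan-resp B xB≗z (x , λ _ → refl))
    where
    B⊆M : ∀ i → RowSpan M (B i)
    B⊆M i = Equivalence.to (Z⇔M (B i)) (A⊆Z (B i) (Equivalence.from (A⇔B (B i)) (rowSpan-row B i)))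
    C = proj₁ ∘ B⊆M
    z∈M = Equivalence.to (Z⇔M z) Zz
    preimage = vectInjection⇒surjective 1≤k (λ x → comb x C)
                 (coefficients-injective B B-unimodular M C (proj₂ ∘ B⊆M)) d≤m (proj₁ z∈M)
    x = proj₁ preimage
    xB≗z : comb x B ≗ z
    xB≗z j = begin
      comb x B j             ≡⟨ comb-congʳ x (proj₂ ∘ B⊆M) j ⟩
      comb x (C · M) j       ≡⟨ comb-assoc x C M j ⟨
      comb (comb x C) M j    ≡⟨ comb-congˡ M (proj₂ preimage) j ⟩
      comb (proj₁ z∈M) M j   ≡⟨ proj₂ z∈M j ⟨
      z j                    ∎

  joinIs-spanned : ∀ {m n} {P₁ P₂ A : Subset k n} → IsSubspace m A → P₁ ⊆ A → P₂ ⊆ A →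
                   (B : Mat k m n) → Unimodular B → A ⊆ RowSpan B → (∀ i → P₁ (B i) ⊎ P₂ (B i)) → JoinIs P₁ P₂ A
  joinIs-spanned {m} {P₁ = P₁} {P₂} {A} A-subspace P₁⊆A P₂⊆A B B-unimodular A⊆B B⊆P₁∪P₂ Z = mk⇔ to from
    where
    B⊆ : ∀ {Z′} → P₁ ⊆ Z′ → P₂ ⊆ Z′ → ∀ i → Z′ (B i)
    B⊆ P₁⊆Z′ P₂⊆Z′ i = [ P₁⊆Z′ (B i) , P₂⊆Z′ (B i) ]′ (B⊆P₁∪P₂ i)
    to : InJoin P₁ P₂ Z → Z ≐ A
    to ((dZ , Z-subspace) , P₁⊆Z , P₂⊆Z , minimal) v = mk⇔ (Z⊆A v) (A⊆Z v)
      where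
      A⊆Z : A ⊆ Z
      A⊆Z v Av = subspace-⊇-rowSpan Z-subspace B (B⊆ P₁⊆Z P₂⊆Z) v (A⊆B v Av)
      Z⊆A : Z ⊆ A
      Z⊆A = subspace-⊆⇒⊇ A-subspace Z-subspace A⊆Z
              (minimal A (m , A-subspace) P₁⊆A P₂⊆A dZ m (subspace⇒hasDim {V = Z} Z-subspace) (subspace⇒hasDim {V = A} A-subspace))
    from : Z ≐ A → InJoin P₁ P₂ Z
    from Z≐A = (m , Z-subspace) , (λ v → A⊆Z v ∘ P₁⊆A v) , (λ v → A⊆Z v ∘ P₂⊆A v) , minimal
      where
      A⊆Z = λ v → Equivalence.from (Z≐A v)
      Z-subspace : IsSubspace m Z
      Z-subspace = subspace-resp-≐ {V = Z} Z≐A A-subspace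
      minimal : ∀ Z′ → (∃[ d′ ] IsSubspace d′ Z′) → P₁ ⊆ Z′ → P₂ ⊆ Z′ →
                ∀ dd dd′ → HasDim Z dd → HasDim Z′ dd′ → dd ≤ dd′
      minimal Z′ _ P₁⊆Z′ P₂⊆Z′ dd dd′ dimZ dimZ′ =
        subst (_≤ dd′) (hasDim-unique {V = Z} (subspace⇒hasDim Z-subspace) dimZ)
          (proj₂ dimZ′ m (B , B-unimodular , unimodular⇒injective B B-unimodular , B⊆ {Z′} P₁⊆Z′ P₂⊆Z′))

-- Determinants

swap₀₁ : ∀ {j} → Fin (suc (suc j)) → Fin (suc (suc j))
swap₀₁ fzero           = fsuc fzero
swap₀₁ (fsuc fzero)    = fzero
swap₀₁ (fsuc (fsuc r)) = fsuc (fsuc r)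

punchIn-punchOut-sym : ∀ {n} (u v : Fin (suc (suc n))) (u≢v : u ≢ v) (v≢u : v ≢ u) (c : Fin n) →
                       punchIn u (punchIn (punchOut u≢v) c) ≡ punchIn v (punchIn (punchOut v≢u) c)
punchIn-punchOut-sym fzero            fzero            u≢v v≢u c        = ⊥-elim (u≢v refl)
punchIn-punchOut-sym fzero            (fsuc v)         u≢v v≢u c        = refl
punchIn-punchOut-sym (fsuc u)         fzero            u≢v v≢u c        = refl
punchIn-punchOut-sym {suc n} (fsuc u) (fsuc v)         u≢v v≢u fzero    = refl
punchIn-punchOut-sym {suc n} (fsuc u) (fsuc v)         u≢v v≢u (fsuc c) =
  cong fsuc (punchIn-punchOut-sym u v (u≢v ∘ cong fsuc) (v≢u ∘ cong fsuc) c)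

module _ {k : ℕ} where

  open ≡-Reasoning

  -x*-y≡x*y : ∀ (x y : ℤq k) → (-ᵣ x) *ᵣ (-ᵣ y) ≡ x *ᵣ y
  -x*-y≡x*y x y = begin
    (-ᵣ x) *ᵣ (-ᵣ y)   ≡⟨ -‿distribˡ-* x (-ᵣ y) ⟨
    -ᵣ (x *ᵣ (-ᵣ y))   ≡⟨ cong -ᵣ_ (-‿distribʳ-* x y) ⟨
    -ᵣ (-ᵣ (x *ᵣ y))   ≡⟨ -‿involutive (x *ᵣ y) ⟩
    x *ᵣ y             ∎

  sum-antisymmetric : ∀ {n} (H : Fin n → Fin n → ℤq k) → (∀ u → H u u ≡ 0ᵣ) → (∀ u v → H v u ≡ -ᵣ H u v) →
                      Σᵣ (λ u → Σᵣ (H u)) ≡ 0ᵣ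
  sum-antisymmetric {zero}  H diag anti = refl
  sum-antisymmetric {suc n} H diag anti = begin
    (H fzero fzero +ᵣ Row₀) +ᵣ Σᵣ (λ u → H (fsuc u) fzero +ᵣ Σᵣ (H (fsuc u) ∘ fsuc))
      ≡⟨ cong₂ _+ᵣ_ (trans (cong (_+ᵣ Row₀) (diag fzero)) (+-identityˡ Row₀))
                    (sum-distrib-+ (λ u → H (fsuc u) fzero) (λ u → Σᵣ (H (fsuc u) ∘ fsuc))) ⟩
    Row₀ +ᵣ (Col₀ +ᵣ Σᵣ (λ u → Σᵣ (H (fsuc u) ∘ fsuc)))
      ≡⟨ cong (λ x → Row₀ +ᵣ (Col₀ +ᵣ x)) (sum-antisymmetric (λ u v → H (fsuc u) (fsuc v)) (diag ∘ fsuc)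
                                                              (λ u v → anti (fsuc u) (fsuc v))) ⟩
    Row₀ +ᵣ (Col₀ +ᵣ 0ᵣ)            ≡⟨ cong (Row₀ +ᵣ_) (+-identityʳ Col₀) ⟩
    Row₀ +ᵣ Col₀                    ≡⟨ sum-distrib-+ (H fzero ∘ fsuc) (λ v → H (fsuc v) fzero) ⟨
    Σᵣ (λ v → H fzero (fsuc v) +ᵣ H (fsuc v) fzero)
      ≡⟨ sum-zero (λ v → trans (cong (H fzero (fsuc v) +ᵣ_) (anti fzero (fsuc v))) (-‿inverseʳ (H fzero (fsuc v)))) ⟩
    0ᵣ                              ∎
    where
    Row₀ = Σᵣ (H fzero ∘ fsuc)
    Col₀ = Σᵣ (λ u → H (fsuc u) fzero)

  sgn-punchOut-anti : ∀ {m} (u v : Fin (suc m)) (u≢v : u ≢ v) (v≢u : v ≢ u) →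
                      sgn {k} u *ᵣ sgn (punchOut u≢v) ≡ -ᵣ (sgn v *ᵣ sgn (punchOut v≢u))
  sgn-punchOut-anti fzero fzero u≢v v≢u = ⊥-elim (u≢v refl)
  sgn-punchOut-anti {suc m} fzero (fsuc v) u≢v v≢u = begin
    1ᵣ *ᵣ sgn v                ≡⟨ *-identityˡ (sgn v) ⟩
    sgn v                      ≡⟨ -‿involutive (sgn v) ⟨
    -ᵣ (-ᵣ sgn v)              ≡⟨ cong -ᵣ_ (*-identityʳ (-ᵣ sgn v)) ⟨
    -ᵣ ((-ᵣ sgn v) *ᵣ 1ᵣ)      ∎
  sgn-punchOut-anti {suc m} (fsuc u) fzero u≢v v≢u = begin
    (-ᵣ sgn u) *ᵣ 1ᵣ           ≡⟨ *-identityʳ (-ᵣ sgn u) ⟩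
    -ᵣ sgn u                   ≡⟨ cong -ᵣ_ (*-identityˡ (sgn u)) ⟨
    -ᵣ (1ᵣ *ᵣ sgn u)           ∎
  sgn-punchOut-anti {suc m} (fsuc u) (fsuc v) u≢v v≢u = begin
    (-ᵣ sgn u) *ᵣ (-ᵣ sgn (punchOut u≢v′))            ≡⟨ -x*-y≡x*y (sgn u) _ ⟩
    sgn u *ᵣ sgn (punchOut u≢v′)                      ≡⟨ sgn-punchOut-anti u v u≢v′ v≢u′ ⟩
    -ᵣ (sgn v *ᵣ sgn (punchOut v≢u′))                 ≡⟨ cong -ᵣ_ (-x*-y≡x*y (sgn v) _) ⟨
    -ᵣ ((-ᵣ sgn v) *ᵣ (-ᵣ sgn (punchOut v≢u′)))       ∎
    where
    u≢v′ = u≢v ∘ cong fsuc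
    v≢u′ = v≢u ∘ cong fsuc

  det-cong : ∀ {j} {M M′ : Mat k j j} → M ≈ₘ M′ → det M ≡ det M′
  det-cong {zero}  M≈M′ = refl
  det-cong {suc j} M≈M′ = sum-cong (λ i →
    cong₂ (λ x y → sgn i *ᵣ (x *ᵣ y)) (M≈M′ fzero i) (det-cong (λ r c → M≈M′ (fsuc r) (punchIn i c))))

  det-idMat : ∀ {j} → det (idMat {k} {j}) ≡ 1ᵣ
  det-idMat {zero}  = refl
  det-idMat {suc j} = begin
    det (idMat {k} {suc j})
      ≡⟨ sum-single fzero term (λ i i≢0 → trans (cong (λ x → sgn i *ᵣ (x *ᵣ minor i)) (idMat-≢ (i≢0 ∘ sym)))
                                                (trans (cong (sgn i *ᵣ_) (zeroˡ (minor i))) (zeroʳ (sgn i)))) ⟩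
    1ᵣ *ᵣ (idMat {k} {suc j} fzero fzero *ᵣ det (λ r c → idMat {k} {suc j} (fsuc r) (fsuc c)))
      ≡⟨ cong₂ (λ x y → 1ᵣ *ᵣ (x *ᵣ y)) (idMat-diag {a = suc j} fzero)
               (trans (det-cong {j} (idMat-reindex fsuc suc-injective)) (det-idMat {j})) ⟩
    1ᵣ *ᵣ (1ᵣ *ᵣ 1ᵣ)       ≡⟨ trans (*-identityˡ _) (*-identityˡ 1ᵣ) ⟩
    1ᵣ                     ∎
    where
    minor : Fin (suc j) → ℤq k
    minor i = det (λ r c → idMat {k} {suc j} (fsuc r) (punchIn i c))
    term : Fin (suc j) → ℤq k
    term i = sgn i *ᵣ (idMat {k} {suc j} fzero i *ᵣ minor i)

  minor₀₁ : ∀ {j} (M : Mat k (suc (suc j)) (suc (suc j))) (u v : Fin (suc (suc j))) → u ≢ v → ℤq k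
  minor₀₁ M u v u≢v = det (λ r c → M (fsuc (fsuc r)) (punchIn u (punchIn (punchOut u≢v) c)))

  -- The (u, v) term of the Laplace expansion of det M along its first two rows.
  term₀₁ : ∀ {j} (M : Mat k (suc (suc j)) (suc (suc j))) → Fin (suc (suc j)) → Fin (suc (suc j)) → ℤq k
  term₀₁ M u v with u ≟ᶠ v
  ... | yes _   = 0ᵣ
  ... | no u≢v = (sgn u *ᵣ sgn (punchOut u≢v)) *ᵣ ((M fzero u *ᵣ M (fsuc fzero) v) *ᵣ minor₀₁ M u v u≢v)

  term₀₁-diag : ∀ {j} (M : Mat k (suc (suc j)) (suc (suc j))) u → term₀₁ M u u ≡ 0ᵣ
  term₀₁-diag M u with u ≟ᶠ u
  ... | yes _  = refl
  ... | no u≢u = ⊥-elim (u≢u refl)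

  term₀₁-punchIn : ∀ {j} (M : Mat k (suc (suc j)) (suc (suc j))) u c →
    term₀₁ M u (punchIn u c) ≡
    sgn u *ᵣ (M fzero u *ᵣ (sgn c *ᵣ (M (fsuc fzero) (punchIn u c)
                                      *ᵣ det (λ r c′ → M (fsuc (fsuc r)) (punchIn u (punchIn c c′))))))
  term₀₁-punchIn M u c with u ≟ᶠ punchIn u c
  ... | yes u≡v = ⊥-elim (punchInᵢ≢i u c (sym u≡v))
  ... | no u≢v  = begin
    (sgn u *ᵣ sgn (punchOut u≢v)) *ᵣ ((M fzero u *ᵣ M (fsuc fzero) v) *ᵣ minor₀₁ M u v u≢v)
      ≡⟨ cong (λ w → (sgn u *ᵣ sgn w) *ᵣ ((M fzero u *ᵣ M (fsuc fzero) v) *ᵣ minor w))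
              (trans (punchOut-cong u refl) (punchOut-punchIn u)) ⟩
    (sgn u *ᵣ sgn c) *ᵣ ((M fzero u *ᵣ M (fsuc fzero) v) *ᵣ minor c)
      ≡⟨ solve 5 (λ s t x y d → (s ⊕ t) ⊕ ((x ⊕ y) ⊕ d) ⊜ s ⊕ (x ⊕ (t ⊕ (y ⊕ d))))
               refl (sgn u) (sgn c) (M fzero u) (M (fsuc fzero) v) (minor c) ⟩
    sgn u *ᵣ (M fzero u *ᵣ (sgn c *ᵣ (M (fsuc fzero) v *ᵣ minor c)))   ∎
    where
    open CommMonoidSolver (CommutativeRing.*-commutativeMonoid (ℤq-commutativeRing {k}))
    v = punchIn u c
    minor = λ w → det (λ r c′ → M (fsuc (fsuc r)) (punchIn u (punchIn w c′)))

  det-expand₀₁ : ∀ {j} (M : Mat k (suc (suc j)) (suc (suc j))) → det M ≡ Σᵣ (λ u → Σᵣ (term₀₁ M u))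
  det-expand₀₁ M = sum-cong λ u → begin
    sgn u *ᵣ (M fzero u *ᵣ Σᵣ (T u))                   ≡⟨ cong (sgn u *ᵣ_) (*-distribˡ-sum (M fzero u) (T u)) ⟩
    sgn u *ᵣ Σᵣ (λ c → M fzero u *ᵣ T u c)             ≡⟨ *-distribˡ-sum (sgn u) (λ c → M fzero u *ᵣ T u c) ⟩
    Σᵣ (λ c → sgn u *ᵣ (M fzero u *ᵣ T u c))           ≡⟨ sum-cong (term₀₁-punchIn M u) ⟨
    Σᵣ (term₀₁ M u ∘ punchIn u)                        ≡⟨ +-identityˡ _ ⟨
    0ᵣ +ᵣ Σᵣ (term₀₁ M u ∘ punchIn u)                  ≡⟨ cong (_+ᵣ Σᵣ (term₀₁ M u ∘ punchIn u)) (term₀₁-diag M u) ⟨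
    term₀₁ M u u +ᵣ Σᵣ (term₀₁ M u ∘ punchIn u)        ≡⟨ sum-remove u (term₀₁ M u) ⟨
    Σᵣ (term₀₁ M u)                                    ∎
    where
    T = λ u c → sgn c *ᵣ (M (fsuc fzero) (punchIn u c) *ᵣ det (λ r c′ → M (fsuc (fsuc r)) (punchIn u (punchIn c c′))))

  term₀₁-swap : ∀ {j} (M M′ : Mat k (suc (suc j)) (suc (suc j))) →
                M′ fzero ≗ M (fsuc fzero) → M′ (fsuc fzero) ≗ M fzero → (∀ r → M′ (fsuc (fsuc r)) ≗ M (fsuc (fsuc r))) →
                ∀ u v → term₀₁ M′ u v ≡ -ᵣ term₀₁ M v u
  term₀₁-swap M M′ row₀ row₁ rows u v with u ≟ᶠ v | v ≟ᶠ u
  ... | yes _   | yes _   = sym -0#≈0#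
  ... | yes u≡v | no v≢u  = ⊥-elim (v≢u (sym u≡v))
  ... | no u≢v  | yes v≡u = ⊥-elim (u≢v (sym v≡u))
  ... | no u≢v  | no v≢u  = begin
    (sgn u *ᵣ sgn (punchOut u≢v)) *ᵣ ((M′ fzero u *ᵣ M′ (fsuc fzero) v) *ᵣ minor₀₁ M′ u v u≢v)
      ≡⟨ cong₂ _*ᵣ_ (sgn-punchOut-anti u v u≢v v≢u) (cong₂ _*ᵣ_ entries minors) ⟩
    (-ᵣ (sgn v *ᵣ sgn (punchOut v≢u))) *ᵣ ((M fzero v *ᵣ M (fsuc fzero) u) *ᵣ minor₀₁ M v u v≢u)
      ≡⟨ -‿distribˡ-* (sgn v *ᵣ sgn (punchOut v≢u)) ((M fzero v *ᵣ M (fsuc fzero) u) *ᵣ minor₀₁ M v u v≢u) ⟨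
    -ᵣ ((sgn v *ᵣ sgn (punchOut v≢u)) *ᵣ ((M fzero v *ᵣ M (fsuc fzero) u) *ᵣ minor₀₁ M v u v≢u)) ∎
    where
    entries : M′ fzero u *ᵣ M′ (fsuc fzero) v ≡ M fzero v *ᵣ M (fsuc fzero) u
    entries = trans (cong₂ _*ᵣ_ (row₀ u) (row₁ v)) (*-comm (M (fsuc fzero) u) (M fzero v))
    minors : minor₀₁ M′ u v u≢v ≡ minor₀₁ M v u v≢u
    minors = det-cong (λ r c → trans (rows r _) (cong (M (fsuc (fsuc r))) (punchIn-punchOut-sym u v u≢v v≢u c)))

  det-swap₀₁ : ∀ {j} (M : Mat k (suc (suc j)) (suc (suc j))) → det (M ∘ swap₀₁) ≡ -ᵣ det M
  det-swap₀₁ M = begin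
    det (M ∘ swap₀₁)                              ≡⟨ det-expand₀₁ (M ∘ swap₀₁) ⟩
    Σᵣ (λ u → Σᵣ (term₀₁ (M ∘ swap₀₁) u))         ≡⟨ sum-cong (λ u → sum-cong (term₀₁-swap M (M ∘ swap₀₁)
                                                       (λ _ → refl) (λ _ → refl) (λ _ _ → refl) u)) ⟩
    Σᵣ (λ u → Σᵣ (λ v → -ᵣ term₀₁ M v u))         ≡⟨ sum-cong (λ u → sum-neg (λ v → term₀₁ M v u)) ⟩
    Σᵣ (λ u → -ᵣ Σᵣ (λ v → term₀₁ M v u))         ≡⟨ sum-neg (λ u → Σᵣ (λ v → term₀₁ M v u)) ⟩
    -ᵣ Σᵣ (λ u → Σᵣ (λ v → term₀₁ M v u))         ≡⟨ cong -ᵣ_ (sum-comm (term₀₁ M)) ⟨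
    -ᵣ Σᵣ (λ v → Σᵣ (term₀₁ M v))                 ≡⟨ cong -ᵣ_ (det-expand₀₁ M) ⟨
    -ᵣ det M                                      ∎

  -- Not a consequence of det-swap₀₁: in characteristic 2,  det M ≡ -ᵣ det M  says nothing.
  det-equal-rows₀₁ : ∀ {j} (M : Mat k (suc (suc j)) (suc (suc j))) → M fzero ≗ M (fsuc fzero) → det M ≡ 0ᵣ
  det-equal-rows₀₁ M row₀≗row₁ = trans (det-expand₀₁ M)
    (sum-antisymmetric (term₀₁ M) (term₀₁-diag M) (λ u v → term₀₁-swap M M row₀≗row₁ (sym ∘ row₀≗row₁) (λ _ _ → refl) v u))

  -- Equal rows 0 and b ≥ 2 become, after swap₀₁, rows 1 and b, which survive together in every
  -- minor of the expansion along row 0; so each cycle of this mutual recursion shrinks the matrix.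
  det-equal-rows      : ∀ {n} (M : Mat k n n) (a b : Fin n) → a ≢ b → M a ≗ M b → det M ≡ 0ᵣ
  det-equal-rows-head : ∀ {n} (M : Mat k (suc n) (suc n)) (b : Fin n) → M fzero ≗ M (fsuc b) → det M ≡ 0ᵣ
  det-equal-rows-tail : ∀ {n} (M : Mat k (suc n) (suc n)) (a b : Fin n) → a ≢ b →
                        M (fsuc a) ≗ M (fsuc b) → det M ≡ 0ᵣ

  det-equal-rows M fzero    fzero    a≢b rows = ⊥-elim (a≢b refl)
  det-equal-rows M fzero    (fsuc b) a≢b rows = det-equal-rows-head M b rows
  det-equal-rows M (fsuc a) fzero    a≢b rows = det-equal-rows-head M a (sym ∘ rows)
  det-equal-rows M (fsuc a) (fsuc b) a≢b rows = det-equal-rows-tail M a b (a≢b ∘ cong fsuc) rows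

  det-equal-rows-head M fzero    rows = det-equal-rows₀₁ M rows
  det-equal-rows-head M (fsuc b) rows = -‿injective (begin
    -ᵣ det M              ≡⟨ det-swap₀₁ M ⟨
    det (M ∘ swap₀₁)      ≡⟨ det-equal-rows-tail (M ∘ swap₀₁) fzero (fsuc b) (λ ()) rows ⟩
    0ᵣ                    ≡⟨ -0#≈0# ⟨
    -ᵣ 0ᵣ                 ∎)

  det-equal-rows-tail M a b a≢b rows = sum-zero λ i → begin
    sgn i *ᵣ (M fzero i *ᵣ det (minor i))   ≡⟨ cong (λ x → sgn i *ᵣ (M fzero i *ᵣ x))
                                                   (det-equal-rows (minor i) a b a≢b (rows ∘ punchIn i)) ⟩
    sgn i *ᵣ (M fzero i *ᵣ 0ᵣ)              ≡⟨ trans (cong (sgn i *ᵣ_) (zeroʳ (M fzero i))) (zeroʳ (sgn i)) ⟩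
    0ᵣ                                      ∎
    where
    minor = λ i r c → M (fsuc r) (punchIn i c)

-- Enlarging a unimodular family

module _ {k : ℕ} where

  open ≡-Reasoning

  transpose : ∀ {a b} → Mat k a b → Mat k b a
  transpose M i j = M j i

  dot : ∀ {n} → Vect k n → Vect k n → ℤq k
  dot x y = Σᵣ (λ c → x c *ᵣ y c)

  dot-sub : ∀ {n} (x y z : Vect k n) → dot x (y -ᵥ z) ≡ dot x y +ᵣ (-ᵣ dot x z)
  dot-sub x y z = begin
    Σᵣ (λ c → x c *ᵣ (y c +ᵣ (-ᵣ z c)))            ≡⟨ sum-cong (λ c → x[y-z]≈xy-xz (x c) (y c) (z c)) ⟩
    Σᵣ (λ c → x c *ᵣ y c +ᵣ (-ᵣ (x c *ᵣ z c)))     ≡⟨ sum-distrib-+ (λ c → x c *ᵣ y c) (λ c → -ᵣ (x c *ᵣ z c)) ⟩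
    dot x y +ᵣ Σᵣ (λ c → -ᵣ (x c *ᵣ z c))         ≡⟨ cong (dot x y +ᵣ_) (sum-neg (λ c → x c *ᵣ z c)) ⟩
    dot x y +ᵣ (-ᵣ dot x z)                       ∎

  dot-transpose : ∀ {n d} (x : Vect k n) (t : Vect k d) (N : Mat k n d) →
                  dot x (comb t (transpose N)) ≡ dot t (comb x N)
  dot-transpose x t N = begin
    Σᵣ (λ c → x c *ᵣ Σᵣ (λ j → t j *ᵣ N c j))      ≡⟨ sum-cong (λ c → *-distribˡ-sum (x c) (λ j → t j *ᵣ N c j)) ⟩
    Σᵣ (λ c → Σᵣ (λ j → x c *ᵣ (t j *ᵣ N c j)))    ≡⟨ sum-comm (λ c j → x c *ᵣ (t j *ᵣ N c j)) ⟩
    Σᵣ (λ j → Σᵣ (λ c → x c *ᵣ (t j *ᵣ N c j)))    ≡⟨ sum-cong (λ j → sum-cong (λ c → x∙yz≈y∙xz (x c) (t j) (N c j))) ⟩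
    Σᵣ (λ j → Σᵣ (λ c → t j *ᵣ (x c *ᵣ N c j)))    ≡⟨ sum-cong (λ j → *-distribˡ-sum (t j) (λ c → x c *ᵣ N c j)) ⟨
    Σᵣ (λ j → t j *ᵣ Σᵣ (λ c → x c *ᵣ N c j))      ∎

  rowSpan-∷ : ∀ {d n} (u : Vect k n) (B : Mat k d n) {v : Vect k n} → RowSpan B v → RowSpan (u ∷ B) v
  rowSpan-∷ u B (c , v≗cB) = (0ᵣ ∷ c) , λ j →
    trans (v≗cB j) (sym (trans (cong (_+ᵣ comb c B j) (zeroˡ (u j))) (+-identityˡ (comb c B j))))

  module KernelProjection {d n} (B : Mat k d n) (N : Mat k n d) (BN≈I : (B · N) ≈ₘ idMat) where

    InKernel : Vect k n → Set
    InKernel v = ∀ j → comb v N j ≡ 0ᵣ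

    project : Vect k n → Vect k n
    project x = x -ᵥ comb (comb x N) B

    project-inKernel : ∀ x → InKernel (project x)
    project-inKernel x j = begin
      comb (project x) N j                             ≡⟨ comb-sub x (comb (comb x N) B) N j ⟩
      comb x N j +ᵣ (-ᵣ comb (comb (comb x N) B) N j)  ≡⟨ cong (λ z → comb x N j +ᵣ (-ᵣ z)) (comb-cancel B N BN≈I (comb x N) j) ⟩
      comb x N j +ᵣ (-ᵣ comb x N j)                    ≡⟨ -‿inverseʳ (comb x N j) ⟩
      0ᵣ                                               ∎

    project-fixes : ∀ x → InKernel x → project x ≗ x
    project-fixes x x∈K l = begin
      x l +ᵣ (-ᵣ comb (comb x N) B l)    ≡⟨ cong (λ z → x l +ᵣ (-ᵣ z)) (trans (comb-congˡ B x∈K l) (comb-zeroˡ B l)) ⟩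
      x l +ᵣ (-ᵣ 0ᵣ)                     ≡⟨ cong (x l +ᵣ_) -0#≈0# ⟩
      x l +ᵣ 0ᵣ                          ≡⟨ +-identityʳ (x l) ⟩
      x l                                ∎

    project-cong : ∀ {x y} → x ≗ y → project x ≗ project y
    project-cong x≗y l = cong₂ (λ a b → a +ᵣ (-ᵣ b)) (x≗y l) (comb-congˡ B (comb-congˡ N x≗y) l)

    project-* : ∀ r x → project (λ l → r *ᵣ x l) ≗ (λ l → r *ᵣ project x l)
    project-* r x l = begin
      r *ᵣ x l +ᵣ (-ᵣ comb (comb (λ l → r *ᵣ x l) N) B l)
        ≡⟨ cong (λ z → r *ᵣ x l +ᵣ (-ᵣ z)) (trans (comb-congˡ B (comb-* r x N) l) (comb-* r (comb x N) B l)) ⟩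
      r *ᵣ x l +ᵣ (-ᵣ (r *ᵣ comb (comb x N) B l))
        ≡⟨ x[y-z]≈xy-xz r (x l) (comb (comb x N) B l) ⟨
      r *ᵣ project x l ∎

    project-split : ∀ x → x ≗ (λ l → project x l +ᵣ comb (comb x N) B l)
    project-split x l = sym (//-rightDividesˡ (comb (comb x N) B l) (x l))

    correct : Vect k n → Vect k n
    correct e = e -ᵥ comb (λ j → dot (B j) e) (transpose N)

    row·correct≡0 : ∀ e i → dot (B i) (correct e) ≡ 0ᵣ
    row·correct≡0 e i = begin
      dot (B i) (correct e)                          ≡⟨ dot-sub (B i) e (comb t (transpose N)) ⟩
      t i +ᵣ (-ᵣ dot (B i) (comb t (transpose N)))   ≡⟨ cong (λ x → t i +ᵣ (-ᵣ x)) (dot-transpose (B i) t N) ⟩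
      t i +ᵣ (-ᵣ dot t (comb (B i) N))               ≡⟨ cong (λ x → t i +ᵣ (-ᵣ x)) (sum-cong (λ j →
                                                          cong (t j *ᵣ_) (trans (BN≈I i j) (idMat-sym i j)))) ⟩
      t i +ᵣ (-ᵣ Σᵣ (λ j → t j *ᵣ idMat j i))        ≡⟨ cong (λ x → t i +ᵣ (-ᵣ x)) (sum-idMatʳ i t) ⟩
      t i +ᵣ (-ᵣ t i)                                ≡⟨ -‿inverseʳ (t i) ⟩
      0ᵣ                                             ∎
      where
      t = λ j → dot (B j) e

    inKernel·correct : ∀ e {u} → InKernel u → dot u (correct e) ≡ dot u e
    inKernel·correct e {u} u∈K = begin
      dot u (correct e)                              ≡⟨ dot-sub u e (comb t (transpose N)) ⟩
      dot u e +ᵣ (-ᵣ dot u (comb t (transpose N)))   ≡⟨ cong (λ x → dot u e +ᵣ (-ᵣ x)) (dot-transpose u t N) ⟩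
      dot u e +ᵣ (-ᵣ dot t (comb u N))               ≡⟨ cong (λ x → dot u e +ᵣ (-ᵣ x))
                                                          (sum-zero (λ j → trans (cong (t j *ᵣ_) (u∈K j)) (zeroʳ (t j)))) ⟩
      dot u e +ᵣ (-ᵣ 0ᵣ)                             ≡⟨ cong (dot u e +ᵣ_) -0#≈0# ⟩
      dot u e +ᵣ 0ᵣ                                  ≡⟨ +-identityʳ (dot u e) ⟩
      dot u e                                        ∎
      where
      t = λ j → dot (B j) e

  unimodular-∷ : ∀ {d n} (B : Mat k d n) (N : Mat k n d) (BN≈I : (B · N) ≈ₘ idMat) →
                 (u : Vect k n) → KernelProjection.InKernel B N BN≈I u → ∀ l y → u l *ᵣ y ≡ 1ᵣ →
                 Unimodular (u ∷ B)
  unimodular-∷ {d} {n} B N BN≈I u u∈K l y uₗy≡1 = N′ , u∷B·N′≈I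
    where
    open KernelProjection B N BN≈I
    e : Vect k n
    e c = idMat c l *ᵣ y
    u·e≡1 : dot u e ≡ 1ᵣ
    u·e≡1 = begin
      Σᵣ (λ c → u c *ᵣ (idMat c l *ᵣ y))   ≡⟨ sum-cong (λ c → *-assoc (u c) (idMat c l) y) ⟨
      Σᵣ (λ c → (u c *ᵣ idMat c l) *ᵣ y)   ≡⟨ *-distribʳ-sum y (λ c → u c *ᵣ idMat c l) ⟨
      Σᵣ (λ c → u c *ᵣ idMat c l) *ᵣ y     ≡⟨ cong (_*ᵣ y) (sum-idMatʳ l u) ⟩
      u l *ᵣ y                             ≡⟨ uₗy≡1 ⟩
      1ᵣ                                   ∎
    N′ : Mat k n (suc d)
    N′ c = correct e c ∷ N c
    u∷B·N′≈I : ((u ∷ B) · N′) ≈ₘ idMat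
    u∷B·N′≈I fzero    fzero    = trans (trans (inKernel·correct e {u} u∈K) u·e≡1) (sym (idMat-diag {a = suc d} fzero))
    u∷B·N′≈I fzero    (fsuc j) = trans (u∈K j) (sym (idMat-≢ {i = fzero} {fsuc j} (λ ())))
    u∷B·N′≈I (fsuc i) fzero    = trans (row·correct≡0 e i) (sym (idMat-≢ {i = fsuc i} {fzero} (λ ())))
    u∷B·N′≈I (fsuc i) (fsuc j) = trans (BN≈I i j) (sym (idMat-reindex fsuc suc-injective i j))

-- Reduced echelon form

module _ {k : ℕ} where

  open ≡-Reasoning

  record IsReducedEchelon {m n} (R : Mat k m n) : Set where
    field
      pivot           : Fin m → Fin n
      pivot-injective : Injective _≡_ _≡_ pivot
      at-pivot        : ∀ i j → R i (pivot j) ≡ idMat i j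

  open IsReducedEchelon

  Echelon : ∀ {m n} → Mat k m n → Set
  Echelon {m} {n} B = Σ (Mat k m n) λ R → IsReducedEchelon R × (∀ i → RowSpan B (R i)) × (∀ i → RowSpan R (B i))

  isReducedEchelon⇒unimodular : ∀ {m n} {R : Mat k m n} → IsReducedEchelon R → Unimodular R
  isReducedEchelon⇒unimodular {R = R} E =
    (λ c j → idMat c (pivot E j)) , λ i j → trans (sum-idMatʳ (pivot E j) (R i)) (at-pivot E i j)

  clear-pivots : ∀ {m n} {R : Mat k m n} (E : IsReducedEchelon R) (b : Vect k n) →
                 ∀ j → (b -ᵥ comb (b ∘ pivot E) R) (pivot E j) ≡ 0ᵣ
  clear-pivots {R = R} E b j = begin
    b (pivot E j) +ᵣ (-ᵣ Σᵣ (λ i → b (pivot E i) *ᵣ R i (pivot E j)))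
      ≡⟨ cong (λ x → b (pivot E j) +ᵣ (-ᵣ x))
              (trans (sum-cong (λ i → cong (b (pivot E i) *ᵣ_) (at-pivot E i j))) (sum-idMatʳ j (b ∘ pivot E))) ⟩
    b (pivot E j) +ᵣ (-ᵣ b (pivot E j))   ≡⟨ -‿inverseʳ (b (pivot E j)) ⟩
    0ᵣ                                    ∎

  head-reduced·N₀≡1 : ∀ {m m′ n} (B : Mat k (suc m) n) (N : Mat k n (suc m)) → (B · N) ≈ₘ idMat →
                      (R : Mat k m′ n) → (∀ i → RowSpan (B ∘ fsuc) (R i)) →
                      ∀ c → comb (B fzero -ᵥ comb c R) N fzero ≡ 1ᵣ
  head-reduced·N₀≡1 {m} B N BN≈I R R⊆B₁ c = begin
    comb (B fzero -ᵥ comb c R) N fzero                    ≡⟨ comb-sub (B fzero) (comb c R) N fzero ⟩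
    comb (B fzero) N fzero +ᵣ (-ᵣ comb (comb c R) N fzero) ≡⟨ cong₂ (λ x y → x +ᵣ (-ᵣ y))
                                                                (trans (BN≈I fzero fzero) (idMat-diag {a = suc m} fzero))
                                                                (comb-assoc c R N fzero) ⟩
    1ᵣ +ᵣ (-ᵣ comb c (R · N) fzero)                       ≡⟨ cong (λ x → 1ᵣ +ᵣ (-ᵣ x))
                                                                (sum-zero (λ j → trans (cong (c j *ᵣ_) (RN₀≡0 j)) (zeroʳ (c j)))) ⟩
    1ᵣ +ᵣ (-ᵣ 0ᵣ)                                         ≡⟨ cong (1ᵣ +ᵣ_) -0#≈0# ⟩
    1ᵣ +ᵣ 0ᵣ                                              ≡⟨ +-identityʳ 1ᵣ ⟩
    1ᵣ                                                    ∎
    where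
    RN₀≡0 : ∀ i → comb (R i) N fzero ≡ 0ᵣ
    RN₀≡0 i = begin
      comb (R i) N fzero                 ≡⟨ comb-congˡ N (proj₂ (R⊆B₁ i)) fzero ⟩
      comb (comb C (B ∘ fsuc)) N fzero   ≡⟨ comb-assoc C (B ∘ fsuc) N fzero ⟩
      comb C ((B ∘ fsuc) · N) fzero      ≡⟨ sum-zero (λ i′ → trans (cong (C i′ *ᵣ_) (trans (BN≈I (fsuc i′) fzero)
                                              (idMat-≢ {i = fsuc i′} {fzero} (λ ())))) (zeroʳ (C i′))) ⟩
      0ᵣ                                 ∎
      where
      C = proj₁ (R⊆B₁ i)

  module PivotStep {m n} (R : Mat k m n) (b : Vect k n) (c : Vect k m) (l : Fin n) (y : ℤq k)
                   (b′ₗy≡1 : (b -ᵥ comb c R) l *ᵣ y ≡ 1ᵣ) where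

    b′ : Vect k n
    b′ = b -ᵥ comb c R

    u : Vect k n
    u j = y *ᵣ b′ j

    R′ : Mat k (suc m) n
    R′ = u ∷ λ i → R i -ᵥ (λ j → R i l *ᵣ u j)

    uₗ≡1 : u l ≡ 1ᵣ
    uₗ≡1 = trans (*-comm y (b′ l)) b′ₗy≡1

    R′⊆b∷R : ∀ i → RowSpan (b ∷ R) (R′ i)
    R′⊆b∷R fzero    = rowSpan-* (b ∷ R) y (rowSpan-sub (b ∷ R) (rowSpan-row (b ∷ R) fzero)
                                                    (rowSpan-comb (b ∷ R) R (rowSpan-row (b ∷ R) ∘ fsuc) c))
    R′⊆b∷R (fsuc i) = rowSpan-sub (b ∷ R) (rowSpan-row (b ∷ R) (fsuc i)) (rowSpan-* (b ∷ R) (R i l) (R′⊆b∷R fzero))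

    R⊆R′ : ∀ i → RowSpan R′ (R i)
    R⊆R′ i = rowSpan-resp R′ (λ j → //-rightDividesˡ (R i l *ᵣ u j) (R i j))
               (rowSpan-+ R′ (rowSpan-row R′ (fsuc i)) (rowSpan-* R′ (R i l) (rowSpan-row R′ fzero)))

    b′≗b′ₗu : ∀ j → b′ l *ᵣ u j ≡ b′ j
    b′≗b′ₗu j = begin
      b′ l *ᵣ (y *ᵣ b′ j)    ≡⟨ *-assoc (b′ l) y (b′ j) ⟨
      (b′ l *ᵣ y) *ᵣ b′ j    ≡⟨ cong (_*ᵣ b′ j) b′ₗy≡1 ⟩
      1ᵣ *ᵣ b′ j             ≡⟨ *-identityˡ (b′ j) ⟩
      b′ j                   ∎

    b∷R⊆R′ : ∀ i → RowSpan R′ ((b ∷ R) i)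
    b∷R⊆R′ fzero    = rowSpan-resp R′ (λ j → //-rightDividesˡ (comb c R j) (b j))
                        (rowSpan-+ R′ (rowSpan-resp R′ b′≗b′ₗu (rowSpan-* R′ (b′ l) (rowSpan-row R′ fzero)))
                                      (rowSpan-comb R′ R R⊆R′ c))
    b∷R⊆R′ (fsuc i) = R⊆R′ i

module _ {k : ℕ} (1≤k : 1 ≤ k) where

  open IsReducedEchelon

  isReducedEchelon-∷ : ∀ {m n} {R : Mat k m n} (E : IsReducedEchelon R) (u : Vect k n) (l : Fin n) →
                       u l ≡ 1ᵣ → (∀ j → u (pivot E j) ≡ 0ᵣ) →
                       IsReducedEchelon (u ∷ λ i → R i -ᵥ (λ j → R i l *ᵣ u j))
  isReducedEchelon-∷ {m} {R = R} E u l uₗ≡1 u-pivot =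
    record { pivot = l ∷ pivot E ; pivot-injective = injective ; at-pivot = at-pivot′ }
    where
    l≢pivot : ∀ j → l ≢ pivot E j
    l≢pivot j l≡pⱼ = 1ᵣ≢0ᵣ 1≤k (trans (sym uₗ≡1) (trans (cong u l≡pⱼ) (u-pivot j)))
    injective : Injective _≡_ _≡_ (l ∷ pivot E)
    injective {fzero}  {fzero}  _   = refl
    injective {fzero}  {fsuc j} eq  = ⊥-elim (l≢pivot j eq)
    injective {fsuc i} {fzero}  eq  = ⊥-elim (l≢pivot i (sym eq))
    injective {fsuc i} {fsuc j} eq  = cong fsuc (pivot-injective E eq)
    at-pivot′ : ∀ i j → (u ∷ λ i → R i -ᵥ (λ j → R i l *ᵣ u j)) i ((l ∷ pivot E) j) ≡ idMat i j
    at-pivot′ fzero    fzero    = trans uₗ≡1 (sym (idMat-diag {a = suc m} fzero))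
    at-pivot′ fzero    (fsuc j) = trans (u-pivot j) (sym (idMat-≢ {i = fzero} {fsuc j} (λ ())))
    at-pivot′ (fsuc i) fzero    =
      trans (cong (λ x → R i l +ᵣ (-ᵣ x)) (trans (cong (R i l *ᵣ_) uₗ≡1) (*-identityʳ (R i l))))
            (trans (-‿inverseʳ (R i l)) (sym (idMat-≢ {i = fsuc i} {fzero} (λ ()))))
    at-pivot′ (fsuc i) (fsuc j) =
      trans (cong (λ x → R i (pivot E j) +ᵣ (-ᵣ x)) (trans (cong (R i l *ᵣ_) (u-pivot j)) (zeroʳ (R i l))))
            (trans (cong (R i (pivot E j) +ᵣ_) -0#≈0#)
                   (trans (+-identityʳ (R i (pivot E j)))
                          (trans (at-pivot E i j) (sym (idMat-reindex fsuc suc-injective i j)))))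

-- Ranks of a matrix listing the rows of another

++-all : ∀ {A : Set} {m n} (P : A → Set) (xs : Fin m → A) (ys : Fin n → A) →
         (∀ i → P (xs i)) → (∀ j → P (ys j)) → ∀ i → P ((xs ++ ys) i)
++-all {m = m} P xs ys Pxs Pys i with splitAt m i
... | inj₁ i′ = Pxs i′
... | inj₂ j  = Pys j

rowSpan⇒factorsThrough : ∀ {k a r n} (S : Mat k a n) (M : Mat k r n) → (∀ i → RowSpan M (S i)) → FactorsThrough S r
rowSpan⇒factorsThrough S M S⊆M = proj₁ ∘ S⊆M , M , proj₂ ∘ S⊆M

minorIdeal-∋-minor : ∀ {k a b} (j : ℕ) (M : Mat k a b) {x} → IsMinor j M x → MinorIdeal j M x
minorIdeal-∋-minor zero    M x-minor = _
minorIdeal-∋-minor (suc j) M {x} x-minor =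
  1 , (λ _ → 1ᵣ) , (λ _ → x) , (λ _ → x-minor) , sym (trans (+-identityʳ (1ᵣ *ᵣ x)) (*-identityˡ x))

annZero-∋1 : ∀ {k} {I : ℤq k → Set} → I 1ᵣ → AnnZero I
annZero-∋1 1∈I x xI≡0 = trans (sym (*-identityʳ x)) (xI≡0 1ᵣ 1∈I)

module RowsOf {k a r n : ℕ} (B : Mat k r n) (S : Mat k a n) (σ : Fin a → Fin r) (κ : Fin r → Fin a)
              (σ∘κ≗id : ∀ i → σ (κ i) ≡ i) (S≡Bσ : ∀ i j → S i j ≡ B (σ i) j) where

  open IsReducedEchelon

  κ-injective : Injective _≡_ _≡_ κ
  κ-injective {i} {j} κi≡κj = trans (sym (σ∘κ≗id i)) (trans (cong σ κi≡κj) (σ∘κ≗id j))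

  S∘κ≡B : ∀ i j → S (κ i) j ≡ B i j
  S∘κ≡B i j = trans (S≡Bσ (κ i) j) (cong (λ l → B l j) (σ∘κ≗id i))

  innerRank-rowsOf : 1 ≤ k → Unimodular B → InnerRank S r
  innerRank-rowsOf 1≤k B-unimodular =
      ((λ i → idMat (σ i)) , B , λ i j → trans (S≡Bσ i j) (sym (sum-idMatˡ (σ i) (λ l → B l j))))
    , λ r′ (C , D , S≈CD) →
        unimodular-in-span⇒≤ 1≤k B D B-unimodular (λ i → C (κ i) , λ j → trans (sym (S∘κ≡B i j)) (S≈CD (κ i) j))

  -- By pigeonhole, a minor of size > r repeats a row of B.
  large-minor-zero : ∀ {j} → r < j → ∀ {z} → IsMinor j S z → z ≡ 0ᵣ
  large-minor-zero r<j (f , g , _ , _ , z≡det) = equal-rows (pigeonhole r<j (σ ∘ f))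
    where
    equal-rows : ∃[ i₁ ] ∃[ i₂ ] (i₁ Fin.< i₂ × σ (f i₁) ≡ σ (f i₂)) → _ ≡ 0ᵣ
    equal-rows (i₁ , i₂ , i₁<i₂ , σfi₁≡σfi₂) = trans z≡det (det-equal-rows _ i₁ i₂ (<⇒≢ i₁<i₂) λ c →
      trans (S≡Bσ (f i₁) (g c)) (trans (cong (λ l → B l (g c)) σfi₁≡σfi₂) (sym (S≡Bσ (f i₂) (g c)))))

  large-minorIdeal-zero : ∀ j → r < j → ∀ {y} → MinorIdeal j S y → y ≡ 0ᵣ
  large-minorIdeal-zero (suc j) r<j (t , c , g , g-minors , y≡Σ) =
    trans y≡Σ (sum-zero (λ i → trans (cong (c i *ᵣ_) (large-minor-zero r<j (g-minors i))) (zeroʳ (c i))))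

  mcCoyRank-rowsOf : 1 ≤ k → IsReducedEchelon B → McCoyRank S r
  mcCoyRank-rowsOf 1≤k E = annZero-∋1 (minorIdeal-∋-minor r S unit-minor) , bounded
    where
    unit-minor : IsMinor r S 1ᵣ
    unit-minor = κ , pivot E , κ-injective , pivot-injective E ,
      sym (trans (det-cong (λ i j → trans (S∘κ≡B i (pivot E j)) (at-pivot E i j))) (det-idMat {j = r}))
    bounded : ∀ j → AnnZero (MinorIdeal j S) → j ≤ r
    bounded j Ann≡0 with j ℕ.≤? r
    ... | yes j≤r = j≤r
    ... | no  j≰r = ⊥-elim (1ᵣ≢0ᵣ 1≤k (Ann≡0 1ᵣ (λ y y∈I →
                      trans (*-identityˡ y) (large-minorIdeal-zero j (ℕ.≰⇒> j≰r) y∈I))))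

module InitTail {k d n : ℕ} (B : Mat k (suc (suc d)) n) where

  σ : Fin (suc d ℕ.+ suc d) → Fin (suc (suc d))
  σ i = [ inject₁ , fsuc ]′ (splitAt (suc d) i)

  κ : Fin (suc (suc d)) → Fin (suc d ℕ.+ suc d)
  κ fzero    = fzero ↑ˡ suc d
  κ (fsuc i) = suc d ↑ʳ i

  σ∘κ≗id : ∀ i → σ (κ i) ≡ i
  σ∘κ≗id fzero    = refl
  σ∘κ≗id (fsuc i) = cong [ inject₁ , fsuc ]′ (splitAt-↑ʳ (suc d) (suc d) i)

  init++tail≡Bσ : ∀ i j → (init B ++ tail B) i j ≡ B (σ i) j
  init++tail≡Bσ i j with splitAt (suc d) i
  ... | inj₁ _ = refl
  ... | inj₂ _ = refl

  open RowsOf B (init B ++ tail B) σ κ σ∘κ≗id init++tail≡Bσ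

  innerRank-init++tail : 1 ≤ k → Unimodular B → InnerRank (init B ++ tail B) (suc (suc d))
  innerRank-init++tail = innerRank-rowsOf

  mcCoyRank-init++tail : 1 ≤ k → IsReducedEchelon B → McCoyRank (init B ++ tail B) (suc (suc d))
  mcCoyRank-init++tail = mcCoyRank-rowsOf

-- The local ring ℤ/pˢ

module ℤModPrimePower (p s k : ℕ) (p-prime : Prime p) (1≤s : 1 ≤ s) (q≡p^s : suc k ≡ p ^ s) where

  private
    instance
      p-nonZero : NonZero p
      p-nonZero = prime⇒nonZero p-prime

  open ≡-Reasoning

  p≢1 : p ≢ 1
  p≢1 = ℕ.nonTrivial⇒≢1 {{prime⇒nonTrivial p-prime}}

  p∣q : p ∣ suc k
  p∣q = subst (p ∣_) (sym q≡p^s) (p∣p^s 1≤s)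
    where
    p∣p^s : ∀ {t} → 1 ≤ t → p ∣ p ^ t
    p∣p^s {suc t} _ = m∣m*n (p ^ t)

  1≤k : 1 ≤ k
  1≤k = positive k p∣q
    where
    positive : ∀ k′ → p ∣ suc k′ → 1 ≤ k′
    positive zero    p∣1 = ⊥-elim (p≢1 (∣1⇒≡1 p∣1))
    positive (suc _) _   = s≤s z≤n

  NonUnit : ℤq k → Set
  NonUnit x = p ∣ toℕ x

  nonUnit? : ∀ x → Dec (NonUnit x)
  nonUnit? x = p ∣? toℕ x

  nonUnit-reduce : ∀ m → p ∣ m → NonUnit (reduce m)
  nonUnit-reduce m p∣m = subst (p ∣_) (sym (toℕ-reduce m))
    (m%n≡0⇒n∣m (m % suc k) p (trans (m∣n⇒o%n%m≡o%m p (suc k) m p∣q) (n∣m⇒m%n≡0 m p p∣m)))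

  nonUnit-*ʳ : ∀ x y → NonUnit x → NonUnit (x *ᵣ y)
  nonUnit-*ʳ x y p∣x = nonUnit-reduce (toℕ x ℕ.* toℕ y) (∣m⇒∣m*n (toℕ y) p∣x)

  nonUnit-sum : ∀ {j} (f : Fin j → ℤq k) → (∀ i → NonUnit (f i)) → NonUnit (Σᵣ f)
  nonUnit-sum {zero}  f p∣f = p ∣0
  nonUnit-sum {suc j} f p∣f =
    nonUnit-reduce (toℕ (f fzero) ℕ.+ toℕ (Σᵣ (f ∘ fsuc))) (∣m∣n⇒∣m+n (p∣f fzero) (nonUnit-sum (f ∘ fsuc) (p∣f ∘ fsuc)))

  ¬nonUnit-1 : ¬ NonUnit 1ᵣ
  ¬nonUnit-1 p∣1 = p≢1 (∣1⇒≡1 (subst (p ∣_) (toℕ-1ᵣ 1≤k) p∣1))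

  pᵣ : ℤq k
  pᵣ = reduce p

  nonUnit⇒pᵣ* : ∀ x → NonUnit x → ∃[ y ] x ≡ pᵣ *ᵣ y
  nonUnit⇒pᵣ* x (divides c x≡cp) = reduce c , (begin
    x                   ≡⟨ reduce-toℕ x ⟨
    reduce (toℕ x)      ≡⟨ cong reduce (trans x≡cp (ℕ.*-comm c p)) ⟩
    reduce (p ℕ.* c)    ≡⟨ reduce-* p c ⟩
    pᵣ *ᵣ reduce c      ∎)

  pᵣ^ : ℕ → ℤq k
  pᵣ^ i = reduce (p ^ i)

  pᵣ^-suc : ∀ i → pᵣ^ (suc i) ≡ pᵣ *ᵣ pᵣ^ i
  pᵣ^-suc i = reduce-* p (p ^ i)

  pᵣ^-vanish : ∀ i → s ≤ i → pᵣ^ i ≡ 0ᵣ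
  pᵣ^-vanish i s≤i = reduce-cong (p ^ i) 0 (n∣m⇒m%n≡0 (p ^ i) (suc k) q∣p^i)
    where
    q∣p^i : suc k ∣ p ^ i
    q∣p^i = subst (_∣ p ^ i) (sym q≡p^s)
              (subst (λ t → p ^ s ∣ p ^ t) (ℕ.m+[n∸m]≡n s≤i)
                (subst (p ^ s ∣_) (sym (ℕ.^-distribˡ-+-* p s (i ∸ s))) (m∣m*n (p ^ (i ∸ s)))))

  prime-power-∣-cancel : ∀ x → ¬ p ∣ x → ∀ t z → p ^ t ∣ x ℕ.* z → p ^ t ∣ z
  prime-power-∣-cancel x p∤x zero    z _ = 1∣ z
  prime-power-∣-cancel x p∤x (suc t) z p^[1+t]∣xz with euclidsLemma x z p-prime (m*n∣⇒m∣ p (p ^ t) p^[1+t]∣xz)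
  ... | inj₁ p∣x = ⊥-elim (p∤x p∣x)
  ... | inj₂ (divides z′ z≡z′p) =
    subst (p ^ suc t ∣_) (trans (ℕ.*-comm p z′) (sym z≡z′p))
      (*-monoʳ-∣ p (prime-power-∣-cancel x p∤x t z′ (*-cancelˡ-∣ p p*p^t∣p*xz′)))
    where
    xz≡p*xz′ : x ℕ.* z ≡ p ℕ.* (x ℕ.* z′)
    xz≡p*xz′ = trans (cong (x ℕ.*_) (trans z≡z′p (ℕ.*-comm z′ p)))
                     (CommSemigroupProperties.x∙yz≈y∙xz ℕ.*-commutativeSemigroup x p z′)
    p*p^t∣p*xz′ : p ℕ.* p ^ t ∣ p ℕ.* (x ℕ.* z′)
    p*p^t∣p*xz′ = subst (p ℕ.* p ^ t ∣_) xz≡p*xz′ p^[1+t]∣xz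

  unit-cancel : ∀ x y → ¬ NonUnit x → x *ᵣ y ≡ 0ᵣ → y ≡ 0ᵣ
  unit-cancel x y p∤x xy≡0 = toℕ-injective (trans (sym (m<n⇒m%n≡m (toℕ<n y))) (n∣m⇒m%n≡0 (toℕ y) (suc k) q∣y))
    where
    q∣xy : suc k ∣ toℕ x ℕ.* toℕ y
    q∣xy = m%n≡0⇒n∣m _ (suc k) (trans (sym (toℕ-reduce (toℕ x ℕ.* toℕ y))) (cong toℕ xy≡0))
    q∣y : suc k ∣ toℕ y
    q∣y = subst (_∣ toℕ y) (sym q≡p^s) (prime-power-∣-cancel (toℕ x) p∤x s (toℕ y) (subst (_∣ _) q≡p^s q∣xy))

  unit-injective : ∀ x → ¬ NonUnit x → Injective _≡_ _≡_ (x *ᵣ_)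
  unit-injective x p∤x {y} {y′} xy≡xy′ = x∙y⁻¹≈ε⇒x≈y y y′ (unit-cancel x (y +ᵣ (-ᵣ y′)) p∤x (begin
    x *ᵣ (y +ᵣ (-ᵣ y′))          ≡⟨ x[y-z]≈xy-xz x y y′ ⟩
    x *ᵣ y +ᵣ (-ᵣ (x *ᵣ y′))     ≡⟨ cong (λ z → z +ᵣ (-ᵣ (x *ᵣ y′))) xy≡xy′ ⟩
    x *ᵣ y′ +ᵣ (-ᵣ (x *ᵣ y′))    ≡⟨ -‿inverseʳ (x *ᵣ y′) ⟩
    0ᵣ                            ∎))

  ¬nonUnit⇒invertible : ∀ x → ¬ NonUnit x → ∃[ y ] x *ᵣ y ≡ 1ᵣ
  ¬nonUnit⇒invertible x p∤x = fin-injective⇒surjective (x *ᵣ_) (unit-injective x p∤x) ℕ.≤-refl 1ᵣ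

  sum-unit⇒unit : ∀ {j} (f : Fin j → ℤq k) → ¬ NonUnit (Σᵣ f) → ∃[ i ] ¬ NonUnit (f i)
  sum-unit⇒unit f p∤Σf with any? (λ i → ¬? (nonUnit? (f i)))
  ... | yes unit = unit
  ... | no  none = ⊥-elim (p∤Σf (nonUnit-sum f (λ i → decidable-stable (nonUnit? (f i)) (λ p∤fi → none (i , p∤fi)))))

  HasUnitEntry : ∀ {n} → Vect k n → Set
  HasUnitEntry u = ∃[ l ] ¬ NonUnit (u l)

  module _ {d n} (B : Mat k d n) (N : Mat k n d) (BN≈I : (B · N) ≈ₘ idMat) where

    open KernelProjection B N BN≈I

    -- pᵣ^ i · v  is the vector we started from; as pᵣ^ s ≡ 0ᵣ, dividing v by p and projecting
    -- back into the kernel can be repeated at most s times before a unit entry appears.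
    kernel-primitive′ : ∀ f i → s ≤ i ℕ.+ f → ∀ v → InKernel v → ¬ (∀ l → pᵣ^ i *ᵣ v l ≡ 0ᵣ) →
                        ∃[ μ ] ∃[ u ] (InKernel u × HasUnitEntry u × (∀ l → pᵣ^ i *ᵣ v l ≡ μ *ᵣ u l))
    kernel-primitive′ zero i s≤i v v∈K p^iv≢0 =
      ⊥-elim (p^iv≢0 (λ l → trans (cong (_*ᵣ v l) (pᵣ^-vanish i (subst (s ≤_) (ℕ.+-identityʳ i) s≤i))) (zeroˡ (v l))))
    kernel-primitive′ (suc f) i s≤i+1+f v v∈K p^iv≢0 with any? (λ l → ¬? (nonUnit? (v l)))
    ... | yes unit = pᵣ^ i , v , v∈K , unit , λ _ → refl
    ... | no none   = conclude (kernel-primitive′ f (suc i) (subst (s ≤_) (ℕ.+-suc i f) s≤i+1+f) u′ (project-inKernel v′)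
                                                 (λ p^[1+i]u′≡0 → p^iv≢0 (λ l → trans (sym (p^[1+i]u′≡p^iv l)) (p^[1+i]u′≡0 l))))
      where
      p∣v : ∀ l → NonUnit (v l)
      p∣v l = decidable-stable (nonUnit? (v l)) (λ p∤vₗ → none (l , p∤vₗ))
      v′ : Vect k n
      v′ l = proj₁ (nonUnit⇒pᵣ* (v l) (p∣v l))
      u′ = project v′
      p^[1+i]u′≡p^iv : ∀ l → pᵣ^ (suc i) *ᵣ u′ l ≡ pᵣ^ i *ᵣ v l
      p^[1+i]u′≡p^iv l = begin
        pᵣ^ (suc i) *ᵣ u′ l                   ≡⟨ cong (_*ᵣ u′ l) (trans (pᵣ^-suc i) (*-comm pᵣ (pᵣ^ i))) ⟩
        (pᵣ^ i *ᵣ pᵣ) *ᵣ u′ l                 ≡⟨ *-assoc (pᵣ^ i) pᵣ (u′ l) ⟩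
        pᵣ^ i *ᵣ (pᵣ *ᵣ u′ l)                 ≡⟨ cong (pᵣ^ i *ᵣ_) (project-* pᵣ v′ l) ⟨
        pᵣ^ i *ᵣ project (λ l → pᵣ *ᵣ v′ l) l ≡⟨ cong (pᵣ^ i *ᵣ_) (project-cong (λ l → sym (proj₂ (nonUnit⇒pᵣ* (v l) (p∣v l)))) l) ⟩
        pᵣ^ i *ᵣ project v l                  ≡⟨ cong (pᵣ^ i *ᵣ_) (project-fixes v v∈K l) ⟩
        pᵣ^ i *ᵣ v l                          ∎
      conclude : ∃[ μ ] ∃[ u ] (InKernel u × HasUnitEntry u × (∀ l → pᵣ^ (suc i) *ᵣ u′ l ≡ μ *ᵣ u l)) →
                 ∃[ μ ] ∃[ u ] (InKernel u × HasUnitEntry u × (∀ l → pᵣ^ i *ᵣ v l ≡ μ *ᵣ u l))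
      conclude (μ , u , u∈K , unit , u′≡μu) = μ , u , u∈K , unit , λ l → trans (sym (p^[1+i]u′≡p^iv l)) (u′≡μu l)

    kernel-primitive : ∀ v → InKernel v → ¬ (∀ l → v l ≡ 0ᵣ) →
                       ∃[ μ ] ∃[ u ] (InKernel u × HasUnitEntry u × (∀ l → v l ≡ μ *ᵣ u l))
    kernel-primitive v v∈K v≢0 =
      conclude (kernel-primitive′ s 0 ℕ.≤-refl v v∈K (λ 1v≡0 → v≢0 (λ l → trans (sym (*-identityˡ (v l))) (1v≡0 l))))
      where
      conclude : ∃[ μ ] ∃[ u ] (InKernel u × HasUnitEntry u × (∀ l → 1ᵣ *ᵣ v l ≡ μ *ᵣ u l)) →
                 ∃[ μ ] ∃[ u ] (InKernel u × HasUnitEntry u × (∀ l → v l ≡ μ *ᵣ u l))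
      conclude (μ , u , u∈K , unit , 1v≡μu) = μ , u , u∈K , unit , λ l → trans (sym (*-identityˡ (v l))) (1v≡μu l)

  UnimodularCover : ∀ {a n} → ℕ → Mat k a n → Set
  UnimodularCover {n = n} r D = ∃[ d ] (d ≤ r × Σ (Mat k d n) λ B → Unimodular B × (∀ i → RowSpan B (D i)))

  unimodularCover-extend : ∀ {a n} (D : Mat k (suc a) n) → UnimodularCover a (D ∘ fsuc) → UnimodularCover (suc a) D
  unimodularCover-extend D (d , d≤a , B , (N , BN≈I) , D′⊆B) = cases (all? (λ l → project w l ≟ᶠ 0ᵣ))
    where
    open KernelProjection B N BN≈I
    w = D fzero
    cases : Dec (∀ l → project w l ≡ 0ᵣ) → UnimodularCover _ D
    cases (yes w′≡0) = d , ℕ.m≤n⇒m≤1+n d≤a , B , (N , BN≈I) , λ where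
      fzero    → comb w N , λ l → trans (project-split w l) (trans (cong (_+ᵣ comb (comb w N) B l) (w′≡0 l)) (+-identityˡ _))
      (fsuc i) → D′⊆B i
    cases (no w′≢0) = adjoin (kernel-primitive B N BN≈I (project w) (project-inKernel w) w′≢0)
      where
      adjoin : ∃[ μ ] ∃[ u ] (InKernel u × HasUnitEntry u × (∀ l → project w l ≡ μ *ᵣ u l)) → UnimodularCover _ D
      adjoin (μ , u , u∈K , (l , p∤uₗ) , w′≡μu) =
        suc d , s≤s d≤a , u ∷ B , unimodular-∷ B N BN≈I u u∈K l (proj₁ uₗ⁻¹) (proj₂ uₗ⁻¹) , λ where
          fzero    → (μ ∷ comb w N) , λ j → trans (project-split w j) (cong (_+ᵣ comb (comb w N) B j) (w′≡μu j))
          (fsuc i) → rowSpan-∷ u B (D′⊆B i)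
        where
        uₗ⁻¹ = ¬nonUnit⇒invertible (u l) p∤uₗ

  unimodularCover : ∀ {a n} (D : Mat k a n) → UnimodularCover a D
  unimodularCover {zero}  D = 0 , z≤n , (λ ()) , ((λ _ ()) , (λ ())) , (λ ())
  unimodularCover {suc a} D = unimodularCover-extend D (unimodularCover (D ∘ fsuc))

  factorsThrough⇒unimodularCover : ∀ {a r n} (S : Mat k a n) → FactorsThrough S r → UnimodularCover r S
  factorsThrough⇒unimodularCover S (C , D , S≈CD) with unimodularCover D
  ... | d , d≤r , B , B-unimodular , D⊆B =
    d , d≤r , B , B-unimodular , λ i → rowSpan-resp B (sym ∘ S≈CD i) (rowSpan-comb B D D⊆B (C i))

  mcAdjacent-join⇒subspace : ∀ {n} d (P₁ P₂ A : Subset k n) → McAdj d P₁ P₂ → JoinIs P₁ P₂ A → IsSubspace (suc d) A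
  mcAdjacent-join⇒subspace d P₁ P₂ A (X , Y , _ , (P₁⇔X , _) , _ , (P₂⇔Y , _) , (ρ≡1+d , _)) A-join =
    from-join (Equivalence.from (A-join A) (λ _ → mk⇔ (λ x → x) (λ x → x)))
    where
    S = X ++ Y
    X⊆P₁ : ∀ j → P₁ (X j)
    X⊆P₁ j = Equivalence.from (P₁⇔X (X j)) (rowSpan-row X j)
    Y⊆P₂ : ∀ j → P₂ (Y j)
    Y⊆P₂ j = Equivalence.from (P₂⇔Y (Y j)) (rowSpan-row Y j)
    P₁,P₂⊆span : ∀ {d′} (B : Mat k d′ _) → (∀ i → RowSpan B (S i)) → P₁ ⊆ RowSpan B × P₂ ⊆ RowSpan B
    P₁,P₂⊆span B S⊆B =
        (λ v P₁v → rowSpan-⊆ B X (λ j → subst (RowSpan B) (lookup-++ˡ X Y j) (S⊆B (j ↑ˡ d))) v (Equivalence.to (P₁⇔X v) P₁v))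
      , (λ v P₂v → rowSpan-⊆ B Y (λ j → subst (RowSpan B) (lookup-++ʳ X Y j) (S⊆B (d ↑ʳ j))) v (Equivalence.to (P₂⇔Y v) P₂v))
    from-join : InJoin P₁ P₂ A → IsSubspace (suc d) A
    from-join ((dA , A-subspace@(_ , M , _ , A⇔M , _)) , P₁⊆A , P₂⊆A , minimal) =
      subst (λ e → IsSubspace e A) (ℕ.≤-antisym (dA≤ (factorsThrough⇒unimodularCover S (proj₁ ρ≡1+d))) 1+d≤dA) A-subspace
      where
      S⊆M : ∀ i → RowSpan M (S i)
      S⊆M = ++-all (RowSpan M) X Y (λ j → Equivalence.to (A⇔M (X j)) (P₁⊆A (X j) (X⊆P₁ j)))
                                   (λ j → Equivalence.to (A⇔M (Y j)) (P₂⊆A (Y j) (Y⊆P₂ j)))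
      1+d≤dA : suc d ≤ dA
      1+d≤dA = proj₂ ρ≡1+d dA (rowSpan⇒factorsThrough S M S⊆M)
      dA≤ : UnimodularCover (suc d) S → dA ≤ suc d
      dA≤ (d′ , d′≤1+d , B , B-unimodular , S⊆B) = ℕ.≤-trans
        (minimal (RowSpan B) (d′ , B-subspace) (proj₁ (P₁,P₂⊆span B S⊆B)) (proj₂ (P₁,P₂⊆span B S⊆B)) dA d′
                 (subspace⇒hasDim 1≤k A-subspace) (subspace⇒hasDim 1≤k B-subspace))
        d′≤1+d
        where
        B-subspace = rowSpan-isSubspace B B-unimodular

  open IsReducedEchelon

  echelon-step : ∀ {m n} (B : Mat k (suc m) n) → Unimodular B → Echelon (B ∘ fsuc) → Echelon B
  echelon-step B (N , BN≈I) (R₁ , E₁ , R₁⊆B₁ , B₁⊆R₁) =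
    adjoin-pivot (sum-unit⇒unit (λ c → b′ c *ᵣ N c fzero) (subst (¬_ ∘ NonUnit) (sym b′N₀≡1) ¬nonUnit-1))
    where
    b = B fzero
    c = b ∘ pivot E₁
    b′ = b -ᵥ comb c R₁
    b′N₀≡1 : comb b′ N fzero ≡ 1ᵣ
    b′N₀≡1 = head-reduced·N₀≡1 B N BN≈I R₁ R₁⊆B₁ c
    adjoin-pivot : ∃[ l ] ¬ NonUnit (b′ l *ᵣ N l fzero) → Echelon B
    adjoin-pivot (l , p∤b′ₗNₗ₀) =
      R′ , isReducedEchelon-∷ 1≤k E₁ u l uₗ≡1 (λ j → trans (cong (y *ᵣ_) (clear-pivots E₁ b j)) (zeroʳ y)) ,
      (λ i → rowSpan-⊆ B (b ∷ R₁) b∷R₁⊆B (R′ i) (R′⊆b∷R i)) , B⊆R′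
      where
      b′ₗ⁻¹ = ¬nonUnit⇒invertible (b′ l) (p∤b′ₗNₗ₀ ∘ nonUnit-*ʳ (b′ l) (N l fzero))
      y = proj₁ b′ₗ⁻¹
      open PivotStep R₁ b c l y (proj₂ b′ₗ⁻¹) using (u; R′; uₗ≡1; R′⊆b∷R; b∷R⊆R′)
      b∷R₁⊆B : ∀ i → RowSpan B ((b ∷ R₁) i)
      b∷R₁⊆B fzero    = rowSpan-row B fzero
      b∷R₁⊆B (fsuc i) = rowSpan-⊆ B (B ∘ fsuc) (rowSpan-row B ∘ fsuc) (R₁ i) (R₁⊆B₁ i)
      B⊆R′ : ∀ i → RowSpan R′ (B i)
      B⊆R′ fzero    = b∷R⊆R′ fzero
      B⊆R′ (fsuc i) = rowSpan-⊆ R′ R₁ (b∷R⊆R′ ∘ fsuc) (B (fsuc i)) (B₁⊆R₁ i)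

  echelon : ∀ {m n} (B : Mat k m n) → Unimodular B → Echelon B
  echelon {zero}  B _ = B , record { pivot = λ () ; pivot-injective = λ { {()} } ; at-pivot = λ () } , (λ ()) , (λ ())
  echelon {suc m} B B-unimodular =
    echelon-step B B-unimodular (echelon (B ∘ fsuc) (unimodular-reindex B fsuc suc-injective B-unimodular))

  subspace⇒mcAdjacent-join : ∀ {n} d (A : Subset k n) → IsSubspace (suc (suc d)) A →
    ∃[ P₁ ] ∃[ P₂ ] (IsSubspace (suc d) P₁ × IsSubspace (suc d) P₂ × McAdj (suc d) P₁ P₂ × JoinIs P₁ P₂ A)
  subspace⇒mcAdjacent-join {n} d A A-subspace@(_ , B₀ , B₀-unimodular , A⇔B₀ , _) =
    from-echelon (echelon B₀ B₀-unimodular)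
    where
    from-echelon : Echelon B₀ →
      ∃[ P₁ ] ∃[ P₂ ] (IsSubspace (suc d) P₁ × IsSubspace (suc d) P₂ × McAdj (suc d) P₁ P₂ × JoinIs P₁ P₂ A)
    from-echelon (B , E , B⊆B₀ , B₀⊆B) =
      RowSpan X , RowSpan Y , rowSpan-isSubspace X X-unimodular , rowSpan-isSubspace Y Y-unimodular ,
      (X , Y , X-unimodular , rowSpan-isBasis X X-unimodular , Y-unimodular , rowSpan-isBasis Y Y-unimodular ,
       innerRank-init++tail 1≤k B-unimodular , mcCoyRank-init++tail 1≤k E) ,
      joinIs-spanned 1≤k A-subspace (rows⊆A X (rowSpan-row B ∘ inject₁)) (rows⊆A Y (rowSpan-row B ∘ fsuc))
        B B-unimodular A⊆B λ where
          fzero    → inj₁ (rowSpan-row X fzero)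
          (fsuc i) → inj₂ (rowSpan-row Y i)
      where
      open InitTail B using (innerRank-init++tail; mcCoyRank-init++tail)
      B-unimodular = isReducedEchelon⇒unimodular E
      X Y : Mat k (suc d) n
      X = init B
      Y = tail B
      X-unimodular = unimodular-reindex B inject₁ inject₁-injective B-unimodular
      Y-unimodular = unimodular-reindex B fsuc suc-injective B-unimodular
      A⊆B : A ⊆ RowSpan B
      A⊆B v Av = rowSpan-⊆ B B₀ B₀⊆B v (Equivalence.to (A⇔B₀ v) Av)
      rows⊆A : ∀ {a} (M : Mat k a n) → (∀ i → RowSpan B (M i)) → RowSpan M ⊆ A
      rows⊆A M M⊆B v v∈M = Equivalence.from (A⇔B₀ v) (rowSpan-⊆ B₀ B B⊆B₀ v (rowSpan-⊆ B M M⊆B v v∈M))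

lemma5p3 : (p s k : ℕ) → Prime p → 1 ≤ s → suc k ≡ p ^ s →
    (n m : ℕ) → 2 ≤ m → m < n → (A : Subset k n) →
    IsSubspace m A ⇔
      (∃[ P₁ ] ∃[ P₂ ] (IsSubspace (m ∸ 1) P₁ × IsSubspace (m ∸ 1) P₂
        × McAdj (m ∸ 1) P₁ P₂ × JoinIs P₁ P₂ A))
lemma5p3 p s k p-prime 1≤s q≡p^s n (suc (suc d)) (s≤s (s≤s z≤n)) _ A =
  mk⇔ (subspace⇒mcAdjacent-join d A)
      (λ (P₁ , P₂ , _ , _ , P₁∼P₂ , P₁∨P₂≡A) → mcAdjacent-join⇒subspace (suc d) P₁ P₂ A P₁∼P₂ P₁∨P₂≡A)
  where
  open ℤModPrimePower p s k p-prime 1≤s q≡p^s
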